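{- Let $k\ge 3$ and let $b$ denote a positive integer. Then: (1) $va^\equiv_1(K_{1,1})=1$ and $va^\equiv_1(K_{k*1})=\lceil k/2\rceil$; (2) $va^\equiv_1(K_{2,2})=2$ and $va^\equiv_1(K_{k*2})=k$; (3) if $n=3b$, then $va^\equiv_1(K_{n,n})=p(2b:n,n)$ and $va^\equiv_1(K_{k*n})=p(kb:k*n)$; (4) if $n=3b+1$, then $va^\equiv_1(K_{n,n})=p(2b:n,n)$ and $va^\equiv_1(K_{k*n})=kb+\lceil k/2\rceil$; (5) if $n=3b+2$, then $va^\equiv_1(K_{n,n})=2b+2$ and $va^\equiv_1(K_{k*n})=kb+k$.
   Context: All graphs are finite and simple. For a graph $G$ with $N=|V(G)|$ vertices, an equitable $q$-coloring of $G$ is a partition of $V(G)$ into $q$ (possibly empty) independent sets, each of size $\lfloor N/q\rfloor$ or $\lceil N/q\rceil$. An equitable $(q,r)$-tree-coloring of $G$ is a partition of $V(G)$ into $q$ sets, each of size $\lfloor N/q\rfloor$ or $\lceil N/q\rceil$, such that each set induces a forest of maximum degree at most $r$. The strong equitable vertex $r$-arboricity $va^\equiv_r(G)$ is the minimum $p$ such that $G$ has an equitable $(q,r)$-tree-coloring for every integer $q\ge p$. $K_{n_1,\ldots,n_k}$ is the complete $k$-partite graph with partite sets $X_1,\ldots,X_k$, $|X_i|=n_i$; $K_{k*n}$ denotes the complete $k$-partite graph with every partite set of size $n$ ($k\ge2$). Definition of $p$: suppose $K_{n_1,\ldots,n_k}$ has an equitable $q$-coloring. Then $p(q:n_1,\ldots,n_k)=\lceil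 n_1/d\rceil+\cdots+\lceil n_k/d\rceil$, where $d$ is the minimum integer with $d\ge\lceil (n_1+\cdots+n_k)/q\rceil$ satisfying at least one of: (i) there exist $i\ne j$ such that neither $n_i$ nor $n_j$ is divisible by $d$; (ii) there exists $i$ with $n_i/\lfloor n_i/d\rfloor>d+1$. Also $p(q:k*n)$ denotes $p(q:n,\ldots,n)$ with $k$ entries equal to $n$. -}

module Defs where

open import Data.Nat using (ℕ; zero; suc; _+_; _*_; _≤_; _<_)
open import Data.Nat.DivMod using (_/_)
open import Data.Nat.Divisibility using (_∣_)
open import Data.Bool using (Bool; true; false; not; _∧_)
open import Data.Fin using (Fin; zero; suc; inject₁; fromℕ; splitAt; _≟_)
open import Data.Fin.Subset using (∣_∣)
open import Data.Vec using (Vec; []; _∷_; tabulate; lookup; map; sum)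
open import Data.Sum using (_⊎_; inj₁; inj₂; [_,_])
open import Data.Product using (Σ; ∃; _×_; _,_)
open import Data.Empty using (⊥)
open import Data.Unit using (⊤)
open import Function.Definitions using (Injective)
open import Relation.Nullary using (¬_; does)
open import Relation.Binary.PropositionalEquality using (_≡_; _≢_)

⌈_/suc_⌉ : ℕ → ℕ → ℕ
⌈ x /suc y ⌉ = (x + y) / suc y

record Graph : Set where
  field
    N      : ℕ
    adj    : Fin N → Fin N → Bool
    adj-sym    : ∀ u v → adj u v ≡ adj v u
    adj-irrefl : ∀ v → adj v v ≡ false
open Graph public

-- Complete multipartite graph K_{n_1,...,n_k}.  Vertices are Fin (n_1+...+n_k);
-- the first n_1 vertices form X_1, the next n_2 form X_2, etc.

partOf : ∀ {k} (ns : Vec ℕ k) → Fin (sum ns) → Fin k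
partOf []       ()
partOf (n ∷ ns) i = [ (λ _ → zero) , (λ j → suc (partOf ns j)) ] (splitAt n i)

private
  notDoesRefl : ∀ {m} (x : Fin m) → not (does (x ≟ x)) ≡ false
  notDoesRefl x with x ≟ x
  ... | Relation.Nullary.yes _ = Relation.Binary.PropositionalEquality.refl
  ... | Relation.Nullary.no ¬p = Data.Empty.⊥-elim (¬p Relation.Binary.PropositionalEquality.refl)

  notDoesSym : ∀ {m} (x y : Fin m) → not (does (x ≟ y)) ≡ not (does (y ≟ x))
  notDoesSym x y with x ≟ y | y ≟ x
  ... | Relation.Nullary.yes _ | Relation.Nullary.yes _ = Relation.Binary.PropositionalEquality.refl
  ... | Relation.Nullary.no _ | Relation.Nullary.no _ = Relation.Binary.PropositionalEquality.refl
  ... | Relation.Nullary.yes p | Relation.Nullary.no ¬q = Data.Empty.⊥-elim (¬q (Relation.Binary.PropositionalEquality.sym p))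
  ... | Relation.Nullary.no ¬p | Relation.Nullary.yes q = Data.Empty.⊥-elim (¬p (Relation.Binary.PropositionalEquality.sym q))

K : ∀ {k} → Vec ℕ k → Graph
K ns = record
  { N = sum ns
  ; adj = λ u v → not (does (partOf ns u ≟ partOf ns v))
  ; adj-sym = λ u v → notDoesSym (partOf ns u) (partOf ns v)
  ; adj-irrefl = λ v → notDoesRefl (partOf ns v)
  }

Kk* : ℕ → ℕ → Graph
Kk* k n = K (Data.Vec.replicate k n)

-- Colourings c : Fin N → Fin q  (a partition of V(G) into q, possibly
-- empty, sets  c⁻¹(j)).

module _ (G : Graph) where

  classSize : ∀ {q} → (Fin (N G) → Fin q) → Fin q → ℕ
  classSize c j = ∣ tabulate (λ v → does (c v ≟ j)) ∣

  Equitable : ∀ {q} → (Fin (N G) → Fin q) → Set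
  Equitable {zero}  c = ⊤
  Equitable {suc q} c = ∀ j → classSize c j ≡ N G / suc q
                            ⊎ classSize c j ≡ ⌈ N G /suc q ⌉

  MonoCycle : ∀ {q} → (Fin (N G) → Fin q) → Set
  MonoCycle c =
    Σ ℕ λ m → Σ (Fin (3 + m) → Fin (N G)) λ f →
      Injective _≡_ _≡_ f
      × (∀ i → c (f i) ≡ c (f zero))
      × (∀ (i : Fin (2 + m)) → adj G (f (inject₁ i)) (f (suc i)) ≡ true)
      × adj G (f (fromℕ (2 + m))) (f zero) ≡ true

  classDegree : ∀ {q} → (Fin (N G) → Fin q) → Fin (N G) → ℕ
  classDegree c v = ∣ tabulate (λ w → adj G v w ∧ does (c w ≟ c v)) ∣

  EqTreeColoring : ℕ → ℕ → Set
  EqTreeColoring q r =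
    Σ (Fin (N G) → Fin q) λ c →
      Equitable c × ¬ MonoCycle c × (∀ v → classDegree c v ≤ r)

  AllAbove : ℕ → ℕ → Set
  AllAbove r p = ∀ q → p ≤ q → EqTreeColoring q r

  IsVA : ℕ → ℕ → Set
  IsVA r p = AllAbove r p × (∀ p′ → AllAbove r p′ → p ≤ p′)

-- condition (i) or (ii) for a candidate d (d = 0 never qualifies; in
-- the definition d ≥ ⌈N/q⌉ ≥ 1 anyway).
-- (ii)  n_i / ⌊n_i/d⌋ > d+1  is written  (d+1)·⌊n_i/d⌋ < n_i.
DCond : ∀ {k} → Vec ℕ k → ℕ → Set
DCond ns zero    = ⊥
DCond {k} ns (suc e) =
  (Σ (Fin k) λ i → Σ (Fin k) λ j →
     i ≢ j × ¬ (suc e ∣ lookup ns i) × ¬ (suc e ∣ lookup ns j))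
  ⊎ (Σ (Fin k) λ i → (suc e + 1) * (lookup ns i / suc e) < lookup ns i)

IsD : ∀ {k} → ℕ → Vec ℕ k → ℕ → Set
IsD zero    ns d = ⊥
IsD (suc q) ns d =
  ⌈ sum ns /suc q ⌉ ≤ d × DCond ns d
  × (∀ d′ → ⌈ sum ns /suc q ⌉ ≤ d′ → d′ < d → ¬ DCond ns d′)

sumCeil : ∀ {k} → Vec ℕ k → ℕ → ℕ
sumCeil ns zero    = 0
sumCeil ns (suc e) = sum (map (λ n → ⌈ n /suc e ⌉) ns)

IsP : ∀ {k} → ℕ → Vec ℕ k → ℕ → Set
IsP q ns v = Σ ℕ λ d → IsD q ns d × v ≡ sumCeil ns d

module Submission where

-- Number the vertices of K_{k*n} 0, …, kn − 1 part by part.  Colourings come from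
-- cutting this sequence into q consecutive blocks of almost equal size such that every
-- block of size at least 3 lies inside one part: then each vertex has at most one
-- neighbour in its class, so the classes induce forests of maximum degree 1.
-- Conversely, in a (q, 1)-tree-colouring every class with at least 3 vertices lies
-- inside one part.  Hence a part holds at most n/3 such classes, which gives
-- kn ≤ 2q + k⌊n/3⌋ when all classes have at most 3 vertices; and when all classes
-- have s or s + 1 ≥ 3 vertices every part is a union of classes, which for
-- q = k⌈n/d⌉ − 1 forces d ∣ n, contradicting the choice of d in p(q : k*n).

open import Defs
open import Data.Nat
open import Data.Nat.Properties
open import Data.Nat.DivMod
open import Data.Nat.Divisibility using (_∣_; divides; _∣?_; ∣⇒≤)
open import Data.Nat.ListAction using (sum)
open import Data.Nat.ListAction.Properties using (sum-++)
open import Data.Nat.Tactic.RingSolver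
open import Algebra.Properties.CommutativeSemigroup +-commutativeSemigroup using (interchange)
open import Data.Bool using (Bool; true; false; not; _∧_)
open import Data.Fin as F using (Fin; zero; suc; toℕ; _↑ˡ_; _↑ʳ_; splitAt; fromℕ<)
open import Data.Fin.Properties as Fin using (toℕ-injective; toℕ-↑ˡ; toℕ-↑ʳ; toℕ-fromℕ<; toℕ<n; splitAt⁻¹-↑ˡ; splitAt⁻¹-↑ʳ; splitAt-↑ˡ; splitAt-↑ʳ)
open import Data.Fin.Subset using (∣_∣)
open import Data.List as L using (List; []; _∷_; length; _++_)
open import Data.List.Properties using (length-++; length-replicate)
open import Data.List.Relation.Unary.All using (All; []; _∷_)
open import Data.List.Relation.Unary.All.Properties using (++⁺; replicate⁺)
open import Data.Vec as V using (Vec; []; _∷_; tabulate; lookup; replicate)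
open import Data.Vec.Properties using (lookup-replicate; map-replicate)
open import Data.Product
open import Data.Sum using (_⊎_; inj₁; inj₂; [_,_]′) renaming (map to ⊎map)
open import Data.Empty
open import Data.Unit using (⊤; tt)
open import Function using (_∘_)
open import Relation.Nullary
open import Relation.Nullary.Decidable using (dec-true; dec-false; ¬?; decidable-stable)
open import Relation.Unary using (Decidable)
open import Relation.Binary.PropositionalEquality

-- Arithmetic

least′ : (P : ℕ → Set) → Decidable P → ∀ g lo w → lo + g ≡ w → P w →
        Σ ℕ λ d → lo ≤ d × P d × (∀ d′ → lo ≤ d′ → d′ < d → ¬ P d′)
least′ P P? g lo w e pw with P? lo
... | yes p = lo , ≤-refl , p , λ d′ l1 l2 → ⊥-elim (<-irrefl refl (<-≤-trans l2 l1))
least′ P P? zero lo w e pw | no np = ⊥-elim (np (subst P (sym (trans (sym (+-identityʳ lo)) e)) pw))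
least′ P P? (suc g) lo w e pw | no np =
   let (d , ld , pd , mn) = least′ P P? g (suc lo) w (trans (sym (+-suc lo g)) e) pw in
   d , ≤-trans (n≤1+n lo) ld , pd , λ d′ l1 l2 → [ (λ l → mn d′ l l2) , (λ e′ → subst (λ t → ¬ P t) e′ np) ]′ (m≤n⇒m<n∨m≡n l1)

least : (P : ℕ → Set) → Decidable P → ∀ lo w → lo ≤ w → P w →
        Σ ℕ λ d → lo ≤ d × P d × (∀ d′ → lo ≤ d′ → d′ < d → ¬ P d′)
least P P? lo w lw pw = least′ P P? (w ∸ lo) lo w (m+[n∸m]≡n lw) pw

m+o≡n⇒m≤n : ∀ {m n} o → m + o ≡ n → m ≤ n
m+o≡n⇒m≤n {m} o refl = m≤m+n m o

/-unique : ∀ m n i .{{_ : NonZero n}} → i * n ≤ m → m < i * n + n → m / n ≡ i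
/-unique m n i p q = ≤-antisym
  (s≤s⁻¹ (*-cancelʳ-< n (m / n) (suc i) (≤-<-trans (m/n*n≤m m n) (subst (m <_) (+-comm (i * n) n) q))))
  (s≤s⁻¹ (*-cancelʳ-< n i (suc (m / n)) (≤-<-trans p
      (subst (_< suc (m / n) * n) (sym (trans (m≡m%n+[m/n]*n m n) (+-comm (m % n) _)))
         (subst (m / n * n + m % n <_) (+-comm (m / n * n) n) (+-monoʳ-< (m / n * n) (m%n<n m n)))))))

[m+n]/n≡1+m/n : ∀ m n .{{_ : NonZero n}} → (m + n) / n ≡ suc (m / n)
[m+n]/n≡1+m/n m n = trans (m/n≡1+[m∸n]/n (m≤n+m n m)) (cong (λ t → suc (t / n)) (m+n∸n≡m m n))

⌈/⌉-unique : ∀ X q′ c → c * suc q′ ≤ X + q′ → X + q′ < suc c * suc q′ → ⌈ X /suc q′ ⌉ ≡ c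
⌈/⌉-unique X q′ c l1 l2 = /-unique (X + q′) (suc q′) c l1 (subst (X + q′ <_) (+-comm (suc q′) (c * suc q′)) l2)

ceil≡floor⊎suc-floor : ∀ N q′ → (N + q′) / suc q′ ≡ N / suc q′ ⊎ (N + q′) / suc q′ ≡ suc (N / suc q′)
ceil≡floor⊎suc-floor N q′ with m≤n⇒m<n∨m≡n (/-monoˡ-≤ (suc q′) (m≤m+n N q′))
... | inj₂ e = inj₁ (sym e)
... | inj₁ lt = inj₂ (≤-antisym (≤-trans (/-monoˡ-≤ (suc q′) (+-monoʳ-≤ N (n≤1+n q′))) (≤-reflexive ([m+n]/n≡1+m/n N (suc q′)))) lt)

/-bounds : ∀ x m .{{_ : NonZero m}} → m * (x / m) ≤ x × x < m * suc (x / m)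
/-bounds x m =
  let eq = m≡m%n+[m/n]*n x m in
  ≤-trans (≤-reflexive (*-comm m (x / m))) (≤-trans (m≤n+m (x / m * m) (x % m)) (≤-reflexive (sym eq))) ,
  ≤-trans (s≤s (≤-reflexive eq)) (≤-trans (+-monoˡ-≤ (x / m * m) (m%n<n x m)) (≤-reflexive (*-comm (suc (x / m)) m)))

ceilMultiple-bounds : ∀ n e → n ≤ (n + e) / suc e * suc e × (n + e) / suc e * suc e < n + suc e
ceilMultiple-bounds n e =
  let m0 = (n + e) / suc e in
  let r = (n + e) % suc e in
  let eq : n + e ≡ r + m0 * suc e
      eq = m≡m%n+[m/n]*n (n + e) (suc e) in
  let rl : r < suc e
      rl = m%n<n (n + e) (suc e) in
  +-cancelʳ-≤ e n (m0 * suc e) (≤-pred (≤-trans (s≤s (≤-reflexive eq)) (≤-trans (+-monoˡ-≤ (m0 * suc e) rl) (≤-reflexive (r1 m0 e))))) ,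
  ≤-<-trans (≤-trans (m≤n+m (m0 * suc e) r) (≤-reflexive (sym eq))) (+-monoʳ-< n (n<1+n e))
  where
  r1 : ∀ m0 e → suc e + m0 * suc e ≡ suc (m0 * suc e + e)
  r1 = solve-∀

ceilQuotient≤b : ∀ n b e → 3 ≤ e → 1 ≤ b → n ≤ 3 * b + 1 → (n + e) / suc e * suc e < n + suc e → (n + e) / suc e ≤ b
ceilQuotient≤b n b e e3 b1 nb lt with (n + e) / suc e ≤? b
... | yes p = p
... | no p = ⊥-elim (<-irrefl refl (<-≤-trans lt (≤-trans chain (*-monoˡ-≤ (suc e) (≰⇒> p)))))
  where
  chain : n + suc e ≤ suc b * suc e
  chain = ≤-trans (+-monoˡ-≤ (suc e) nb) (≤-trans (+-monoˡ-≤ (suc e) (+-monoʳ-≤ (3 * b) b1))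
            (≤-trans (+-monoˡ-≤ (suc e) (≤-trans (≤-reflexive (r b)) (*-monoʳ-≤ b (s≤s e3)))) (≤-reflexive (+-comm (b * suc e) (suc e)))))
    where r : ∀ b → 3 * b + b ≡ b * 4
          r = solve-∀

3*x≤m⇒x≤m/3 : ∀ x m → 3 * x ≤ m → x ≤ m / 3
3*x≤m⇒x≤m/3 x m le = ≤-trans (≤-reflexive (sym (m*n/n≡m x 3))) (/-monoˡ-≤ 3 (≤-trans (≤-reflexive (*-comm x 3)) le))

[3b+r]/3≡b : ∀ b r → r < 3 → (3 * b + r) / 3 ≡ b
[3b+r]/3≡b b r r3 = /-unique (3 * b + r) 3 b (≤-trans (≤-reflexive (*-comm b 3)) (m≤m+n (3 * b) r))
  (subst (3 * b + r <_) (cong (_+ 3) (*-comm 3 b)) (+-monoʳ-< (3 * b) r3))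

3t≢3b+r : ∀ t b r → 0 < r → r < 3 → 3 * t ≡ 3 * b + r → ⊥
3t≢3b+r t b r r0 r3 eq with t ≤? b
... | yes tb = <-irrefl refl (≤-<-trans (*-monoʳ-≤ 3 tb) (subst (3 * b <_) (sym eq) (m<m+n (3 * b) r0)))
... | no tb = <-irrefl refl (<-≤-trans (subst (_< 3 * b + 3) (sym eq) (+-monoʳ-< (3 * b) r3))
                (≤-trans (≤-reflexive (trans (+-comm (3 * b) 3) (sym (*-suc 3 b)))) (*-monoʳ-≤ 3 (≰⇒> tb))))

divMod2 : ∀ m → Σ ℕ λ c → Σ ℕ λ d → d ≤ 1 × m ≡ 2 * c + d
divMod2 zero = 0 , 0 , z≤n , refl
divMod2 (suc m) with divMod2 m
... | c , zero , _ , e = c , 1 , s≤s z≤n , trans (cong suc e) (r c)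
  where r : ∀ c → suc (2 * c + 0) ≡ 2 * c + 1
        r = solve-∀
... | c , suc zero , _ , e = suc c , 0 , z≤n , trans (cong suc e) (r c)
  where r : ∀ c → suc (2 * c + 1) ≡ 2 * suc c + 0
        r = solve-∀
... | c , suc (suc d) , s≤s () , e

even-difference : ∀ y z x → y + 2 * z ≡ 2 * x → y ≡ 2 * (x ∸ z)
even-difference y z x e = trans (sym (m+n∸n≡m y (2 * z))) (trans (cong (_∸ 2 * z) e) (sym (*-distribˡ-∸ 2 x z)))

floor-balanced : ∀ s q' N u → u < suc q' → N ≡ s * suc q' + u → N / suc q' ≡ s
floor-balanced s q' N u p refl = /-unique (s * suc q' + u) (suc q') s (m≤m+n _ u) (+-monoʳ-< (s * suc q') p)

ceil-balanced : ∀ s q' N u → 1 ≤ u → u ≤ suc q' → N ≡ s * suc q' + u → (N + q') / suc q' ≡ suc s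
ceil-balanced s q' N (suc u') _ ul refl with m≤n⇒∃[o]m+o≡n ul
... | (w , e) with suc-injective e
... | refl = /-unique _ (suc (u' + w)) (suc s) (m+o≡n⇒m≤n u' (lo s u' w)) (m+o≡n⇒m≤n w (hi s u' w))
  where
  lo : ∀ s u' w → suc s * suc (u' + w) + u' ≡ s * suc (u' + w) + suc u' + (u' + w)
  lo = solve-∀
  hi : ∀ s u' w → suc (s * suc (u' + w) + suc u' + (u' + w)) + w ≡ suc s * suc (u' + w) + suc (u' + w)
  hi = solve-∀

⌈3q/q⌉≡3 : ∀ X q′ → X ≡ 3 * suc q′ → ⌈ X /suc q′ ⌉ ≡ 3
⌈3q/q⌉≡3 .(3 * suc q′) q′ refl = ⌈/⌉-unique (3 * suc q′) q′ 3 (m≤m+n _ q′) (m+o≡n⇒m≤n 0 (r q′))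
  where r : ∀ q′ → suc (3 * suc q′ + q′) + 0 ≡ 4 * suc q′
        r = solve-∀

⌈3q+2/q⌉≡4 : ∀ X q′ → 1 ≤ q′ → X ≡ 3 * suc q′ + 2 → ⌈ X /suc q′ ⌉ ≡ 4
⌈3q+2/q⌉≡4 .(3 * suc (suc q″) + 2) (suc q″) _ refl = ⌈/⌉-unique (3 * suc (suc q″) + 2) (suc q″) 4 (m+o≡n⇒m≤n 1 (r1 q″)) (m+o≡n⇒m≤n q″ (r2 q″))
  where r1 : ∀ q → 4 * suc (suc q) + 1 ≡ 3 * suc (suc q) + 2 + suc q
        r1 = solve-∀
        r2 : ∀ q → suc (3 * suc (suc q) + 2 + suc q) + q ≡ 5 * suc (suc q)
        r2 = solve-∀

∣⇒next-multiple≤ : ∀ m s n → m * s < n → s ∣ n → suc m * s ≤ n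
∣⇒next-multiple≤ m s n ms<n (divides w n≡ws) =
  ≤-trans (*-monoˡ-≤ s (*-cancelʳ-< s m w (<-≤-trans ms<n (≤-reflexive n≡ws)))) (≤-reflexive (sym n≡ws))

≡ᵇ-refl : ∀ m → (m ≡ᵇ m) ≡ true
≡ᵇ-refl zero = refl
≡ᵇ-refl (suc m) = ≡ᵇ-refl m

≢⇒≡ᵇ-false : ∀ {m n} → m ≢ n → (m ≡ᵇ n) ≡ false
≢⇒≡ᵇ-false {zero} {zero} ne = ⊥-elim (ne refl)
≢⇒≡ᵇ-false {zero} {suc n} ne = refl
≢⇒≡ᵇ-false {suc m} {zero} ne = refl
≢⇒≡ᵇ-false {suc m} {suc n} ne = ≢⇒≡ᵇ-false {m} {n} (ne ∘ cong suc)

⌈/2⌉-spec : ∀ m → m ≡ 2 * ⌈ m /2⌉ ⊎ suc m ≡ 2 * ⌈ m /2⌉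
⌈/2⌉-spec zero = inj₁ refl
⌈/2⌉-spec (suc zero) = inj₂ refl
⌈/2⌉-spec (suc (suc m)) with ⌈/2⌉-spec m
... | inj₁ e = inj₁ (trans (cong (2 +_) e) (sym (*-suc 2 ⌈ m /2⌉)))
... | inj₂ e = inj₂ (trans (cong (2 +_) e) (sym (*-suc 2 ⌈ m /2⌉)))

n≤2⌈n/2⌉ : ∀ k → k ≤ 2 * ⌈ k /2⌉
n≤2⌈n/2⌉ k with ⌈/2⌉-spec k
... | inj₁ e = ≤-reflexive e
... | inj₂ e = ≤-trans (n≤1+n k) (≤-reflexive e)

2⌈n/2⌉≤1+n : ∀ k → 2 * ⌈ k /2⌉ ≤ suc k
2⌈n/2⌉≤1+n k with ⌈/2⌉-spec k
... | inj₁ e = ≤-trans (≤-reflexive (sym e)) (n≤1+n k)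
... | inj₂ e = ≤-reflexive (sym e)

2*[1+c]≤1+n⇒n≰2*c : ∀ k c′ → 2 * suc c′ ≤ suc k → k ≤ 2 * c′ → ⊥
2*[1+c]≤1+n⇒n≰2*c k c′ h1 h2 = 1+n≰n (≤-trans (≤-pred (subst (_≤ suc k) (*-suc 2 c′) h1)) h2)

k+3≤3⌈k/2⌉ : ∀ k c → 3 ≤ k → k ≢ 4 → (k ≡ 2 * c ⊎ suc k ≡ 2 * c) → k + 3 ≤ 3 * c
k+3≤3⌈k/2⌉ .0 zero () k4 (inj₁ refl)
k+3≤3⌈k/2⌉ .2 (suc zero) (s≤s (s≤s ())) k4 (inj₁ refl)
k+3≤3⌈k/2⌉ k (suc (suc zero)) k3 k4 (inj₁ refl) = ⊥-elim (k4 refl)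
k+3≤3⌈k/2⌉ k (suc (suc (suc c″))) k3 k4 (inj₁ refl) = m+o≡n⇒m≤n c″ (r c″)
  where
  r : ∀ c → 2 * (3 + c) + 3 + c ≡ 3 * (3 + c)
  r = solve-∀
k+3≤3⌈k/2⌉ k zero k3 k4 (inj₂ ())
k+3≤3⌈k/2⌉ (suc (suc (suc k))) (suc zero) k3 k4 (inj₂ ())
k+3≤3⌈k/2⌉ k (suc (suc c″)) k3 k4 (inj₂ e) rewrite suc-injective e = m+o≡n⇒m≤n c″ (r c″)
  where
  r : ∀ c → suc (c + suc (suc (c + 0))) + 3 + c ≡ 3 * (2 + c)
  r = solve-∀

-- Finite sums and counting

𝟙 : Bool → ℕ
𝟙 true = 1
𝟙 false = 0

∑ : ∀ {n} → (Fin n → ℕ) → ℕ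
∑ {zero} f = 0
∑ {suc n} f = f zero + ∑ (f ∘ suc)

count : ∀ {n} → (Fin n → Bool) → ℕ
count f = ∑ (λ i → 𝟙 (f i))

∣tabulate∣≡count : ∀ {n} (f : Fin n → Bool) → ∣ tabulate f ∣ ≡ count f
∣tabulate∣≡count {zero} f = refl
∣tabulate∣≡count {suc n} f with f zero
... | true = cong suc (∣tabulate∣≡count (f ∘ suc))
... | false = ∣tabulate∣≡count (f ∘ suc)

∑-cong : ∀ {n} {f g : Fin n → ℕ} → (∀ i → f i ≡ g i) → ∑ f ≡ ∑ g
∑-cong {zero} e = refl
∑-cong {suc n} e = cong₂ _+_ (e zero) (∑-cong (e ∘ suc))

∑-mono-≤ : ∀ {n} {f g : Fin n → ℕ} → (∀ i → f i ≤ g i) → ∑ f ≤ ∑ g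
∑-mono-≤ {zero} e = z≤n
∑-mono-≤ {suc n} e = +-mono-≤ (e zero) (∑-mono-≤ (e ∘ suc))

∑-distrib-+ : ∀ {n} (f g : Fin n → ℕ) → ∑ (λ i → f i + g i) ≡ ∑ f + ∑ g
∑-distrib-+ {zero} f g = refl
∑-distrib-+ {suc n} f g rewrite ∑-distrib-+ (f ∘ suc) (g ∘ suc) =
  interchange (f zero) (g zero) (∑ (f ∘ suc)) (∑ (g ∘ suc))

∑-const : ∀ {n} c → ∑ {n} (λ _ → c) ≡ n * c
∑-const {zero} c = refl
∑-const {suc n} c = cong (c +_) (∑-const {n} c)

∑-*ˡ : ∀ {n} c (f : Fin n → ℕ) → ∑ (λ i → c * f i) ≡ c * ∑ f
∑-*ˡ {zero} c f = sym (*-zeroʳ c)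
∑-*ˡ {suc n} c f rewrite ∑-*ˡ c (f ∘ suc) = sym (*-distribˡ-+ c (f zero) _)

∑-zero : ∀ {n} (f : Fin n → ℕ) → (∀ i → f i ≡ 0) → ∑ f ≡ 0
∑-zero {n} f e = trans (∑-cong e) (trans (∑-const {n} 0) (*-zeroʳ n))

∑-comm : ∀ {m n} (f : Fin m → Fin n → ℕ) → ∑ (λ i → ∑ (λ j → f i j)) ≡ ∑ (λ j → ∑ (λ i → f i j))
∑-comm {zero} {n} f = sym (∑-zero {n} (λ _ → 0) (λ _ → refl))
∑-comm {suc m} {n} f = begin
  ∑ (f zero) + ∑ (λ i → ∑ (λ j → f (suc i) j)) ≡⟨ cong (∑ (f zero) +_) (∑-comm (f ∘ suc)) ⟩
  ∑ (f zero) + ∑ (λ j → ∑ (λ i → f (suc i) j)) ≡⟨ sym (∑-distrib-+ (f zero) _) ⟩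
  ∑ (λ j → ∑ (λ i → f i j)) ∎
  where open ≡-Reasoning

∑-splitAt : ∀ {m n} (f : Fin (m + n) → ℕ) → ∑ f ≡ ∑ (λ i → f (i ↑ˡ n)) + ∑ (λ i → f (m ↑ʳ i))
∑-splitAt {zero} f = refl
∑-splitAt {suc m} {n} f = trans (cong (f zero +_) (∑-splitAt {m} (f ∘ suc))) (sym (+-assoc (f zero) _ _))

∑-single : ∀ {n} (f : Fin n → ℕ) (k : Fin n) → (∀ i → i ≢ k → f i ≡ 0) → ∑ f ≡ f k
∑-single {suc n} f zero e = trans (cong (f zero +_) (∑-zero (f ∘ suc) (λ i → e (suc i) (λ ())))) (+-identityʳ _)
∑-single {suc n} f (suc k) e = trans (cong (_+ ∑ (f ∘ suc)) (e zero (λ ()))) (∑-single (f ∘ suc) k (λ i ne → e (suc i) (ne ∘ Fin.suc-injective)))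

∑-pos : ∀ {n} (f : Fin n → ℕ) → 1 ≤ ∑ f → Σ (Fin n) λ i → 1 ≤ f i
∑-pos {zero} f ()
∑-pos {suc n} f p with f zero in eq
... | suc _ = zero , subst (1 ≤_) (sym eq) (s≤s z≤n)
... | zero = let (i , q) = ∑-pos (f ∘ suc) p in suc i , q

term≤∑ : ∀ {n} (f : Fin n → ℕ) k → f k ≤ ∑ f
term≤∑ {suc n} f zero = m≤m+n _ _
term≤∑ {suc n} f (suc k) = ≤-trans (term≤∑ (f ∘ suc) k) (m≤n+m _ _)

_==_ : ∀ {n} → Fin n → Fin n → Bool
i == j = does (i F.≟ j)

==⇒≡ : ∀ {n} {i j : Fin n} → (i == j) ≡ true → i ≡ j
==⇒≡ {i = i} {j} e with i F.≟ j
... | yes p = p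

==-false⇒≢ : ∀ {n} {i j : Fin n} → (i == j) ≡ false → i ≢ j
==-false⇒≢ {i = i} {j} e with i F.≟ j
... | no p = p

==-refl : ∀ {n} (i : Fin n) → (i == i) ≡ true
==-refl i with i F.≟ i
... | yes _ = refl
... | no p = ⊥-elim (p refl)

≢⇒==-false : ∀ {n} {i j : Fin n} → i ≢ j → (i == j) ≡ false
≢⇒==-false {i = i} {j} ne with i F.≟ j
... | yes p = ⊥-elim (ne p)
... | no _ = refl

𝟙≤1 : ∀ b → 𝟙 b ≤ 1
𝟙≤1 true = s≤s z≤n
𝟙≤1 false = z≤n

∑<k*m⇒small-term : ∀ {k} (t : Fin k → ℕ) m → ∑ t < k * m → Σ (Fin k) λ i → t i < m
∑<k*m⇒small-term {zero} t m ()
∑<k*m⇒small-term {suc k} t m lt with t zero <? m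
... | yes p = zero , p
... | no p = let (i , q) = ∑<k*m⇒small-term (t ∘ suc) m (+-cancelˡ-< m _ _ (≤-<-trans (+-monoˡ-≤ (∑ (t ∘ suc)) (≮⇒≥ p)) lt)) in suc i , q

k*m<∑⇒big-term : ∀ {k} (t : Fin k → ℕ) m → k * m < ∑ t → Σ (Fin k) λ i → m < t i
k*m<∑⇒big-term {zero} t m ()
k*m<∑⇒big-term {suc k} t m lt with m <? t zero
... | yes p = zero , p
... | no p = let (i , q) = k*m<∑⇒big-term (t ∘ suc) m (+-cancelˡ-< m _ _ (<-≤-trans lt (+-monoˡ-≤ (∑ (t ∘ suc)) (≮⇒≥ p)))) in suc i , q

∑≤1⇒zero-at-0-or-1 : ∀ {k} (u : Fin (suc (suc k)) → ℕ) → ∑ u ≤ 1 → u zero ≡ 0 ⊎ u (suc zero) ≡ 0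
∑≤1⇒zero-at-0-or-1 u le with u zero | u (suc zero)
... | zero | _ = inj₁ refl
... | suc a | zero = inj₂ refl
... | suc a | suc b = ⊥-elim (1+n≰n (≤-trans (+-mono-≤ (s≤s (z≤n {a})) (≤-trans (s≤s (z≤n {b})) (m≤m+n (suc b) _))) le))

∑𝟙[x==j]≡1 : ∀ {q} (x : Fin q) → ∑ (λ j → 𝟙 (x == j)) ≡ 1
∑𝟙[x==j]≡1 {q} x = trans (∑-single {q} _ x (λ i ne → cong 𝟙 (≢⇒==-false (λ e → ne (sym e))))) (cong 𝟙 (==-refl x))

∑-fibres : ∀ {N q} (g : Fin N → Fin q) (w : Fin N → ℕ) →
  ∑ w ≡ ∑ (λ j → ∑ (λ v → 𝟙 (g v == j) * w v))
∑-fibres {N} {q} g w = begin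
  ∑ w ≡⟨ ∑-cong (λ v → sym (trans (∑-*ʳ v) (trans (cong (_* w v) (∑𝟙[x==j]≡1 (g v))) (*-identityˡ (w v))))) ⟩
  ∑ (λ v → ∑ (λ j → 𝟙 (g v == j) * w v)) ≡⟨ ∑-comm {N} {q} (λ v j → 𝟙 (g v == j) * w v) ⟩
  ∑ (λ j → ∑ (λ v → 𝟙 (g v == j) * w v)) ∎
  where
  open ≡-Reasoning
  ∑-*ʳ : ∀ v → ∑ (λ j → 𝟙 (g v == j) * w v) ≡ ∑ (λ j → 𝟙 (g v == j)) * w v
  ∑-*ʳ v = trans (∑-cong (λ j → *-comm (𝟙 (g v == j)) (w v))) (trans (∑-*ˡ {q} (w v) _) (*-comm (w v) _))

∑𝟙[i==x]≡1 : ∀ {n} (x : Fin n) → ∑ (λ i → 𝟙 (i == x)) ≡ 1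
∑𝟙[i==x]≡1 {n} x = trans (∑-single {n} _ x (λ i ne → cong 𝟙 (≢⇒==-false ne))) (cong 𝟙 (==-refl x))

𝟙-pos : ∀ b → 1 ≤ 𝟙 b → b ≡ true
𝟙-pos true _ = refl

𝟙-true : ∀ {b} → b ≡ true → 𝟙 b ≡ 1
𝟙-true refl = refl

count≤1 : ∀ {n} (f : Fin n → Bool) → (∀ x y → f x ≡ true → f y ≡ true → x ≡ y) → count f ≤ 1
count≤1 {n} f u with count f ≤? 0
... | yes p = ≤-trans p z≤n
... | no p =
  let (x , q) = ∑-pos {n} (λ i → 𝟙 (f i)) (≰⇒> p) in
  let fx : f x ≡ true
      fx = 𝟙-pos (f x) q in
  ≤-trans (∑-mono-≤ {n} {g = λ i → 𝟙 (i == x)} (λ i → h i fx)) (≤-reflexive (∑𝟙[i==x]≡1 x))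
  where
  h : ∀ i {x} → f x ≡ true → 𝟙 (f i) ≤ 𝟙 (i == x)
  h i {x} fx with f i in fi
  ... | false = z≤n
  ... | true = ≤-reflexive (sym (𝟙-true (subst (λ t → (t == x) ≡ true) (sym (u i x fi fx)) (==-refl x))))

count≥2 : ∀ {n} (f : Fin n → Bool) x y → f x ≡ true → f y ≡ true → x ≢ y → 2 ≤ count f
count≥2 {n} f x y fx fy ne =
  ≤-trans (≤-reflexive (sym (cong₂ _+_ (∑𝟙[i==x]≡1 x) (∑𝟙[i==x]≡1 y))))
  (≤-trans (≤-reflexive (sym (∑-distrib-+ {n} _ _))) (∑-mono-≤ {n} h))
  where
  h : ∀ i → 𝟙 (i == x) + 𝟙 (i == y) ≤ 𝟙 (f i)
  h i with i F.≟ x | i F.≟ y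
  ... | yes refl | yes refl = ⊥-elim (ne refl)
  ... | yes refl | no _ = ≤-reflexive (sym (𝟙-true fx))
  ... | no _ | yes refl = ≤-reflexive (sym (𝟙-true fy))
  ... | no _ | no _ = z≤n

count≥3⇒third : ∀ {n} (f : Fin n → Bool) → 3 ≤ count f → ∀ x y → Σ (Fin n) λ z → f z ≡ true × z ≢ x × z ≢ y
count≥3⇒third {n} f p x y =
  let g = λ i → f i ∧ not (i == x) ∧ not (i == y) in
  let le : count f ≤ count g + 2
      le = ≤-trans (∑-mono-≤ {n} {g = λ i → 𝟙 (g i) + (𝟙 (i == x) + 𝟙 (i == y))} h)
             (≤-reflexive (trans (∑-distrib-+ {n} _ _) (cong (count g +_) (trans (∑-distrib-+ {n} _ _) (cong₂ _+_ (∑𝟙[i==x]≡1 x) (∑𝟙[i==x]≡1 y)))))) in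
  let (z , q) = ∑-pos {n} (λ i → 𝟙 (g i)) (+-cancelʳ-≤ 2 1 (count g) (≤-trans p le)) in
  z , ext z q
  where
  h : ∀ i → 𝟙 (f i) ≤ 𝟙 (f i ∧ not (i == x) ∧ not (i == y)) + (𝟙 (i == x) + 𝟙 (i == y))
  h i with f i | i == x | i == y
  ... | false | _ | _ = z≤n
  ... | true | true | _ = s≤s z≤n
  ... | true | false | true = s≤s z≤n
  ... | true | false | false = s≤s z≤n
  ext : ∀ z → 1 ≤ 𝟙 (f z ∧ not (z == x) ∧ not (z == y)) → f z ≡ true × z ≢ x × z ≢ y
  ext z q with f z | z F.≟ x | z F.≟ y
  ... | true | no a | no b = refl , a , b
  ... | false | _ | _ = ⊥-elim (1+n≰n q)
  ... | true | yes _ | _ = ⊥-elim (1+n≰n q)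
  ... | true | no _ | yes _ = ⊥-elim (1+n≰n q)

fromℕ<-== : ∀ {q m} (p : m < q) (j : Fin q) → (fromℕ< p == j) ≡ (m ≡ᵇ toℕ j)
fromℕ<-== {q} {m} p j with fromℕ< p F.≟ j
... | yes refl = sym (subst (λ t → (m ≡ᵇ t) ≡ true) (sym (toℕ-fromℕ< p)) (≡ᵇ-refl m))
... | no ne = sym (≢⇒≡ᵇ-false (λ e → ne (toℕ-injective (trans (toℕ-fromℕ< p) e))))

-- Interval colourings

∑ℕ : ℕ → (ℕ → ℕ) → ℕ
∑ℕ N f = ∑ {N} (λ v → f (toℕ v))

∑ℕ-+ : ∀ a b f → ∑ℕ (a + b) f ≡ ∑ℕ a f + ∑ℕ b (λ y → f (a + y))
∑ℕ-+ a b f = trans (∑-splitAt {a} {b} (λ v → f (toℕ v)))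
  (cong₂ _+_ (∑-cong {a} (λ i → cong f (toℕ-↑ˡ i b))) (∑-cong {b} (λ i → cong f (toℕ-↑ʳ a i))))

∑ℕ-cong : ∀ N {f g : ℕ → ℕ} → (∀ x → x < N → f x ≡ g x) → ∑ℕ N f ≡ ∑ℕ N g
∑ℕ-cong N e = ∑-cong (λ v → e (toℕ v) (toℕ<n v))

∑ℕ-const : ∀ N c → ∑ℕ N (λ _ → c) ≡ N * c
∑ℕ-const N c = ∑-const {N} c

-- The colouring used by every construction: cut 0, 1, …, kn − 1 into consecutive
-- blocks of the lengths listed in L, and give x the index of its block.
interval : List ℕ → ℕ → ℕ
interval [] x = 0
interval (ℓ ∷ L) x = go ℓ x
  where
  go : ℕ → ℕ → ℕ
  go zero x = suc (interval L x)
  go (suc ℓ) zero = 0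
  go (suc ℓ) (suc x) = go ℓ x

interval-head : ∀ ℓ L x → x < ℓ → interval (ℓ ∷ L) x ≡ 0
interval-head (suc ℓ) L zero p = refl
interval-head (suc ℓ) L (suc x) (s≤s p) = interval-head ℓ L x p

interval-tail : ∀ ℓ L y → interval (ℓ ∷ L) (ℓ + y) ≡ suc (interval L y)
interval-tail zero L y = refl
interval-tail (suc ℓ) L y = interval-tail ℓ L y

interval-beyond : ∀ ℓ L {t} → ¬ t < ℓ → interval (ℓ ∷ L) t ≡ suc (interval L (t ∸ ℓ))
interval-beyond ℓ L {t} t≮ℓ =
  trans (cong (interval (ℓ ∷ L)) (sym (m+[n∸m]≡n (≮⇒≥ t≮ℓ)))) (interval-tail ℓ L (t ∸ ℓ))

interval-head≢beyond : ∀ ℓ L {x y} → x < ℓ → ¬ y < ℓ → interval (ℓ ∷ L) x ≢ interval (ℓ ∷ L) y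
interval-head≢beyond ℓ L {x} x<ℓ y≮ℓ e =
  0≢1+n (trans (sym (interval-head ℓ L x x<ℓ)) (trans e (interval-beyond ℓ L y≮ℓ)))

interval<length : ∀ L x → x < sum L → interval L x < length L
interval<length (ℓ ∷ L) x p with x <? ℓ
... | yes q = subst (_< suc (length L)) (sym (interval-head ℓ L x q)) (s≤s z≤n)
... | no q with m≤n⇒∃[o]m+o≡n (≮⇒≥ q)
...   | (y , refl) = subst (_< suc (length L)) (sym (interval-tail ℓ L y))
          (s≤s (interval<length L y (+-cancelˡ-< ℓ y (sum L) p)))

nth : List ℕ → ℕ → ℕ
nth [] j = 0
nth (ℓ ∷ L) zero = ℓ
nth (ℓ ∷ L) (suc j) = nth L j

count-interval : ∀ L j → ∑ℕ (sum L) (λ x → 𝟙 (interval L x ≡ᵇ j)) ≡ nth L j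
count-interval [] j = refl
count-interval (ℓ ∷ L) j = begin
  ∑ℕ (ℓ + sum L) (λ x → 𝟙 (interval (ℓ ∷ L) x ≡ᵇ j))
    ≡⟨ ∑ℕ-+ ℓ (sum L) (λ x → 𝟙 (interval (ℓ ∷ L) x ≡ᵇ j)) ⟩
  ∑ℕ ℓ (λ x → 𝟙 (interval (ℓ ∷ L) x ≡ᵇ j)) + ∑ℕ (sum L) (λ y → 𝟙 (interval (ℓ ∷ L) (ℓ + y) ≡ᵇ j))
    ≡⟨ cong₂ _+_ (∑ℕ-cong ℓ (λ x p → cong (λ t → 𝟙 (t ≡ᵇ j)) (interval-head ℓ L x p)))
                 (∑ℕ-cong (sum L) (λ y _ → cong (λ t → 𝟙 (t ≡ᵇ j)) (interval-tail ℓ L y))) ⟩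
  ∑ℕ ℓ (λ _ → 𝟙 (0 ≡ᵇ j)) + ∑ℕ (sum L) (λ y → 𝟙 (suc (interval L y) ≡ᵇ j))
    ≡⟨ split j ⟩
  nth (ℓ ∷ L) j ∎
  where
  open ≡-Reasoning
  split : ∀ j → ∑ℕ ℓ (λ _ → 𝟙 (0 ≡ᵇ j)) + ∑ℕ (sum L) (λ y → 𝟙 (suc (interval L y) ≡ᵇ j)) ≡ nth (ℓ ∷ L) j
  split zero = trans (cong₂ _+_ (∑ℕ-const ℓ 1) (trans (∑ℕ-const (sum L) 0) (*-zeroʳ (sum L))))
                 (trans (+-identityʳ _) (*-identityʳ ℓ))
  split (suc j) = trans (cong (_+ _) (trans (∑ℕ-const ℓ 0) (*-zeroʳ ℓ))) (count-interval L j)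

InsidePart : ℕ → ℕ → ℕ → Set
InsidePart n P ℓ = Σ ℕ λ i → i * n ≤ P × P + ℓ ≤ i * n + n

LongInsideParts : ℕ → ℕ → List ℕ → Set
LongInsideParts n P [] = ⊤
LongInsideParts n P (ℓ ∷ L) = (3 ≤ ℓ → InsidePart n P ℓ) × LongInsideParts n (P + ℓ) L

InPair : ℕ → ℕ → Set
InPair a x = a ≤ x × x < a + 2

InPair-cases : ∀ {a x} → InPair a x → x ≡ a ⊎ x ≡ suc a
InPair-cases {a} {x} (p , q) with m≤n⇒∃[o]m+o≡n p
... | (zero , e) = inj₁ (trans (sym e) (+-identityʳ a))
... | (suc zero , e) = inj₂ (trans (sym e) (+-comm a 1))
... | (suc (suc c) , refl) = ⊥-elim (<-irrefl refl (≤-trans q (m+o≡n⇒m≤n c (lem a c))))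
  where
  lem : ∀ a c → a + 2 + c ≡ a + suc (suc c)
  lem = solve-∀

InPair-pigeonhole : ∀ {a x y z} → InPair a x → InPair a y → InPair a z → x ≢ y → x ≢ z → y ≡ z
InPair-pigeonhole wx wy wz nxy nxz with InPair-cases wx | InPair-cases wy | InPair-cases wz
... | _ | inj₁ refl | inj₁ refl = refl
... | _ | inj₂ refl | inj₂ refl = refl
... | inj₁ refl | inj₁ refl | _ = ⊥-elim (nxy refl)
... | inj₂ refl | inj₂ refl | _ = ⊥-elim (nxy refl)
... | inj₁ refl | inj₂ refl | inj₁ refl = ⊥-elim (nxz refl)
... | inj₂ refl | inj₁ refl | inj₂ refl = ⊥-elim (nxz refl)

SamePartOrPair : ∀ n .{{_ : NonZero n}} → ℕ → ℕ → ℕ → ℕ → Set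
SamePartOrPair n P x y z =
  ((P + x) / n ≡ (P + y) / n × (P + x) / n ≡ (P + z) / n) ⊎ (Σ ℕ λ a → InPair a x × InPair a y × InPair a z)

block-dichotomy : ∀ n .{{_ : NonZero n}} P ℓ {x y z} → (3 ≤ ℓ → InsidePart n P ℓ) →
  x < ℓ → y < ℓ → z < ℓ → SamePartOrPair n P x y z
block-dichotomy n P ℓ long qx qy qz with 3 ≤? ℓ
... | yes big =
  let (i , l1 , l2) = long big
      part : ∀ {t} → t < ℓ → (P + t) / n ≡ i
      part {t} q = /-unique (P + t) n i (≤-trans l1 (m≤m+n P t)) (<-≤-trans (+-monoʳ-< P q) l2)
  in inj₁ (trans (part qx) (sym (part qy)) , trans (part qx) (sym (part qz)))
... | no small = inj₂ (0 , (z≤n , <-≤-trans qx ℓ≤2) , (z≤n , <-≤-trans qy ℓ≤2) , (z≤n , <-≤-trans qz ℓ≤2))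
  where
  ℓ≤2 : ℓ ≤ 0 + 2
  ℓ≤2 = ≤-pred (≰⇒> small)

sameInterval-dichotomy : ∀ n .{{_ : NonZero n}} P L x y z → LongInsideParts n P L →
  x < sum L → y < sum L → z < sum L →
  interval L x ≡ interval L y → interval L x ≡ interval L z → SamePartOrPair n P x y z
sameInterval-dichotomy n P (ℓ ∷ L) x y z (long , rest) px py pz exy exz with x <? ℓ | y <? ℓ | z <? ℓ
... | yes qx | yes qy | yes qz = block-dichotomy n P ℓ long qx qy qz
... | yes qx | no qy | _ = ⊥-elim (interval-head≢beyond ℓ L qx qy exy)
... | yes qx | yes qy | no qz = ⊥-elim (interval-head≢beyond ℓ L qx qz exz)
... | no qx | yes qy | _ = ⊥-elim (interval-head≢beyond ℓ L qy qx (sym exy))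
... | no qx | _ | yes qz = ⊥-elim (interval-head≢beyond ℓ L qz qx (sym exz))
... | no qx | no qy | no qz
  with m≤n⇒∃[o]m+o≡n (≮⇒≥ qx) | m≤n⇒∃[o]m+o≡n (≮⇒≥ qy) | m≤n⇒∃[o]m+o≡n (≮⇒≥ qz)
... | (x′ , refl) | (y′ , refl) | (z′ , refl) =
  ⊎map (λ (e1 , e2) → trans (shift x′) (trans e1 (sym (shift y′))) , trans (shift x′) (trans e2 (sym (shift z′))))
       (λ (a , wx , wy , wz) → ℓ + a , unshift wx , unshift wy , unshift wz)
       (sameInterval-dichotomy n (P + ℓ) L x′ y′ z′ rest
          (+-cancelˡ-< ℓ _ _ px) (+-cancelˡ-< ℓ _ _ py) (+-cancelˡ-< ℓ _ _ pz)
          (suc-injective (trans (sym (interval-tail ℓ L x′)) (trans exy (interval-tail ℓ L y′))))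
          (suc-injective (trans (sym (interval-tail ℓ L x′)) (trans exz (interval-tail ℓ L z′)))))
  where
  shift : ∀ t → (P + (ℓ + t)) / n ≡ (P + ℓ + t) / n
  shift t = cong (_/ n) (sym (+-assoc P ℓ t))
  unshift : ∀ {t a} → InPair a t → InPair (ℓ + a) (ℓ + t)
  unshift {t} {a} (a≤t , t<a+2) = +-monoʳ-≤ ℓ a≤t , subst (ℓ + t <_) (sym (+-assoc ℓ a 2)) (+-monoʳ-< ℓ t<a+2)

sum-replicate : ∀ k n → V.sum (replicate k n) ≡ k * n
sum-replicate zero n = refl
sum-replicate (suc k) n = cong (n +_) (sum-replicate k n)

splitAt-toℕ₁ : ∀ m {n} (i : Fin (m + n)) j → splitAt m i ≡ inj₁ j → toℕ i ≡ toℕ j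
splitAt-toℕ₁ m {n} i j e = trans (cong toℕ (sym (splitAt⁻¹-↑ˡ e))) (toℕ-↑ˡ j n)

splitAt-toℕ₂ : ∀ m {n} (i : Fin (m + n)) j → splitAt m i ≡ inj₂ j → toℕ i ≡ m + toℕ j
splitAt-toℕ₂ m {n} i j e = trans (cong toℕ (sym (splitAt⁻¹-↑ʳ e))) (toℕ-↑ʳ m j)

partOf-toℕ : ∀ k n .{{_ : NonZero n}} (v : Fin (V.sum (replicate k n))) → toℕ (partOf (replicate k n) v) ≡ toℕ v / n
partOf-toℕ (suc k) n v with splitAt n v in e
... | inj₁ j = sym (m<n⇒m/n≡0 (subst (_< n) (sym (splitAt-toℕ₁ n v j e)) (toℕ<n j)))
... | inj₂ j = trans (cong suc (partOf-toℕ k n j))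
   (sym (trans (cong (_/ n) (splitAt-toℕ₂ n v j e)) (trans (cong (_/ n) (+-comm n (toℕ j))) ([m+n]/n≡1+m/n (toℕ j) n))))

-- A monochromatic cycle through f 0, f 1, f 2 gives f 1 two neighbours of its colour.
degree≤1⇒¬MonoCycle : ∀ (G : Graph) {q} (c : Fin (N G) → Fin q) → (∀ v → classDegree G c v ≤ 1) → ¬ MonoCycle G c
degree≤1⇒¬MonoCycle G c deg (m , f , inj , same , path , close) =
  1+n≰n (≤-trans (count≥2 nbr (f zero) (f (suc (suc zero))) nbr₀ nbr₂ f₀≢f₂)
        (≤-trans (≤-reflexive (sym (∣tabulate∣≡count nbr))) (deg (f (suc zero)))))
  where
  nbr = λ w → adj G (f (suc zero)) w ∧ does (c w F.≟ c (f (suc zero)))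
  same′ : ∀ i → (c (f i) == c (f (suc zero))) ≡ true
  same′ i rewrite same i | same (suc zero) = ==-refl (c (f zero))
  nbr₀ : nbr (f zero) ≡ true
  nbr₀ rewrite adj-sym G (f (suc zero)) (f zero) | path zero | same′ zero = refl
  nbr₂ : nbr (f (suc (suc zero))) ≡ true
  nbr₂ rewrite path (suc zero) | same′ (suc (suc zero)) = refl
  f₀≢f₂ : f zero ≢ f (suc (suc zero))
  f₀≢f₂ e with inj e
  ... | ()

EqSize : ℕ → ℕ → Set
EqSize s x = x ≡ s ⊎ x ≡ suc s

-- u counts the entries equal to 1 + s.
EqSize-stats : ∀ s L → All (EqSize s) L → Σ ℕ λ u → u ≤ length L × sum L ≡ s * length L + u
   × (∀ j → j < length L → nth L j ≡ s → u < length L)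
   × (∀ j → j < length L → nth L j ≡ suc s → 1 ≤ u)
EqSize-stats s [] [] = 0 , z≤n , sym (trans (+-identityʳ _) (*-zeroʳ s)) , (λ j ()) , λ j ()
EqSize-stats s (x ∷ L) (inj₁ refl ∷ a) =
  let (u , ul , se , f1 , f2) = EqSize-stats s L a in
  u , m≤n⇒m≤1+n ul , trans (cong (s +_) se) (trans (sym (+-assoc s _ u)) (cong (_+ u) (sym (*-suc s (length L)))))
  , (λ _ _ _ → s≤s ul)
  , λ { zero _ e → ⊥-elim (1+n≢n (sym e)) ; (suc j) (s≤s p) e → f2 j p e }
EqSize-stats s (x ∷ L) (inj₂ refl ∷ a) =
  let (u , ul , se , f1 , f2) = EqSize-stats s L a in
  suc u , s≤s ul , trans (cong (suc s +_) se) (lem (length L) u)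
  , (λ { zero _ e → ⊥-elim (1+n≢n e) ; (suc j) (s≤s p) e → s≤s (f1 j p e) })
  , λ _ _ _ → s≤s z≤n
  where
  lem : ∀ l u → suc s + (s * l + u) ≡ s * suc l + suc u
  lem l u rewrite *-suc s l = shuffle s (s * l) u
    where
    shuffle : ∀ s sl u → suc s + (sl + u) ≡ s + sl + suc u
    shuffle = solve-∀

All-nth : ∀ {P : ℕ → Set} {L} → All P L → ∀ j → j < length L → P (nth L j)
All-nth (p ∷ a) zero _ = p
All-nth (p ∷ a) (suc j) (s≤s q) = All-nth a j q

balanced⇒Equitable : ∀ (G : Graph) {q} (c : Fin (N G) → Fin q) s (L : List ℕ) →
  length L ≡ q → sum L ≡ N G → All (EqSize s) L →
  (∀ j → classSize G c j ≡ nth L (toℕ j)) → Equitable G c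
balanced⇒Equitable G {zero} c s L _ _ _ _ = tt
balanced⇒Equitable G {suc q′} c s L lenL sumL allL size j =
  let (u , u≤ , sum≡ , small , big) = EqSize-stats s L allL
      N≡ : N G ≡ s * suc q′ + u
      N≡ = trans (sym sumL) (trans sum≡ (cong (λ t → s * t + u) lenL))
  in [ (λ e → inj₁ (trans (size j) (trans e (sym
          (floor-balanced s q′ (N G) u (subst (u <_) lenL (small (toℕ j) j<len e)) N≡))))) ,
       (λ e → inj₂ (trans (size j) (trans e (sym
          (ceil-balanced s q′ (N G) u (big (toℕ j) j<len e) (subst (u ≤_) lenL u≤) N≡))))) ]′
     (All-nth allL (toℕ j) j<len)
  where
  j<len : toℕ j < length L
  j<len = subst (toℕ j <_) (sym lenL) (toℕ<n j)

∧-true⇒ : ∀ {a b} → a ∧ b ≡ true → a ≡ true × b ≡ true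
∧-true⇒ {true} {true} _ = refl , refl

not-true⇒ : ∀ {a} → not a ≡ true → a ≡ false
not-true⇒ {false} _ = refl

module IntervalColouring {k n q : ℕ} (L : List ℕ) (lenL : length L ≡ q) (sumL : sum L ≡ k * n) where

  N≡sum : V.sum (replicate k n) ≡ sum L
  N≡sum = trans (sum-replicate k n) (sym sumL)

  toℕ<sum : (v : Fin (V.sum (replicate k n))) → toℕ v < sum L
  toℕ<sum v = subst (toℕ v <_) N≡sum (toℕ<n v)

  colour<q : ∀ v → interval L (toℕ v) < q
  colour<q v = subst (interval L (toℕ v) <_) lenL (interval<length L (toℕ v) (toℕ<sum v))

  colour : Fin (V.sum (replicate k n)) → Fin q
  colour v = fromℕ< (colour<q v)

  toℕ-colour : ∀ v → toℕ (colour v) ≡ interval L (toℕ v)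
  toℕ-colour v = toℕ-fromℕ< _

  classSize-colour : ∀ j → classSize (Kk* k n) colour j ≡ nth L (toℕ j)
  classSize-colour j = begin
    classSize (Kk* k n) colour j
      ≡⟨ ∣tabulate∣≡count (λ v → colour v == j) ⟩
    count (λ v → colour v == j)
      ≡⟨ ∑-cong (λ v → cong 𝟙 (fromℕ<-== (colour<q v) j)) ⟩
    ∑ℕ (V.sum (replicate k n)) (λ x → 𝟙 (interval L x ≡ᵇ toℕ j))
      ≡⟨ cong (λ M → ∑ℕ M (λ x → 𝟙 (interval L x ≡ᵇ toℕ j))) N≡sum ⟩
    ∑ℕ (sum L) (λ x → 𝟙 (interval L x ≡ᵇ toℕ j))
      ≡⟨ count-interval L (toℕ j) ⟩
    nth L (toℕ j) ∎
    where open ≡-Reasoning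

  -- Two neighbours w₁ ≠ w₂ of v in its class put v, w₁, w₂ into one block meeting two
  -- parts; such a block has at most two positions.
  classDegree-colour≤1 : .{{_ : NonZero n}} → LongInsideParts n 0 L → ∀ v → classDegree (Kk* k n) colour v ≤ 1
  classDegree-colour≤1 long v = ≤-trans (≤-reflexive (∣tabulate∣≡count nbr)) (count≤1 nbr unique)
    where
    part = partOf (replicate k n)
    nbr : Fin (V.sum (replicate k n)) → Bool
    nbr w = not (part v == part w) ∧ (colour w == colour v)
    nbr⇒ : ∀ w → nbr w ≡ true → part v ≢ part w × interval L (toℕ v) ≡ interval L (toℕ w)
    nbr⇒ w e = let (a , b) = ∧-true⇒ e in
      ==-false⇒≢ (not-true⇒ a) , trans (sym (toℕ-colour v)) (trans (cong toℕ (sym (==⇒≡ b))) (toℕ-colour w))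
    samePart : ∀ {w} → toℕ v / n ≡ toℕ w / n → part v ≡ part w
    samePart {w} e = toℕ-injective (trans (partOf-toℕ k n v) (trans e (sym (partOf-toℕ k n w))))
    unique : ∀ w₁ w₂ → nbr w₁ ≡ true → nbr w₂ ≡ true → w₁ ≡ w₂
    unique w₁ w₂ e₁ e₂ with nbr⇒ w₁ e₁ | nbr⇒ w₂ e₂
    ... | (n₁ , c₁) | (n₂ , c₂)
      with sameInterval-dichotomy n 0 L (toℕ v) (toℕ w₁) (toℕ w₂) long (toℕ<sum v) (toℕ<sum w₁) (toℕ<sum w₂) c₁ c₂
    ... | inj₁ (same , _) = ⊥-elim (n₁ (samePart same))
    ... | inj₂ (a , wv , w₁∈ , w₂∈) = toℕ-injective (InPair-pigeonhole wv w₁∈ w₂∈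
            (λ e → n₁ (cong part (toℕ-injective e))) (λ e → n₂ (cong part (toℕ-injective e))))

intervalTreeColouring : ∀ k n .{{_ : NonZero n}} q s (L : List ℕ) → length L ≡ q → sum L ≡ k * n →
  All (EqSize s) L → LongInsideParts n 0 L → EqTreeColoring (Kk* k n) q 1
intervalTreeColouring k n q s L lenL sumL allL long =
  colour , balanced⇒Equitable (Kk* k n) colour s L lenL (sym N≡sum) allL classSize-colour ,
  degree≤1⇒¬MonoCycle (Kk* k n) colour (classDegree-colour≤1 long) , classDegree-colour≤1 long
  where open IntervalColouring {k} {n} {q} L lenL sumL

-- Three constructions

sum-replicateᴸ : ∀ a x → sum (L.replicate a x) ≡ a * x
sum-replicateᴸ zero x = refl
sum-replicateᴸ (suc a) x = cong (x +_) (sum-replicateᴸ a x)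

LongInsideParts-++ : ∀ n P L1 L2 → LongInsideParts n P L1 → LongInsideParts n (P + sum L1) L2 → LongInsideParts n P (L1 ++ L2)
LongInsideParts-++ n P [] L2 g1 g2 = subst (λ t → LongInsideParts n t L2) (+-identityʳ P) g2
LongInsideParts-++ n P (ℓ ∷ L1) L2 (g , g1) g2 = g , LongInsideParts-++ n (P + ℓ) L1 L2 g1 (subst (λ t → LongInsideParts n t L2) (sym (+-assoc P ℓ (sum L1))) g2)

LongInsideParts-short : ∀ n P L → All (λ x → x ≤ 2) L → LongInsideParts n P L
LongInsideParts-short n P [] [] = tt
LongInsideParts-short n P (ℓ ∷ L) (p ∷ a) = (λ q → ⊥-elim (<-irrefl refl (≤-trans q p))) , LongInsideParts-short n (P + ℓ) L a

LongInsideParts-inPart : ∀ n i P L → i * n ≤ P → P + sum L ≤ i * n + n → LongInsideParts n P L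
LongInsideParts-inPart n i P [] p q = tt
LongInsideParts-inPart n i P (ℓ ∷ L) p q = (λ _ → i , p , ≤-trans (+-monoʳ-≤ P (m≤m+n ℓ (sum L))) q)
  , LongInsideParts-inPart n i (P + ℓ) L (≤-trans p (m≤m+n P ℓ)) (subst (_≤ i * n + n) (sym (+-assoc P ℓ (sum L))) q)

-- Classes of size at most 2 contain no path on three vertices: take pairs and singletons,
-- or, when q > kn, singletons and empty classes.
smallClassColouring : ∀ k n .{{_ : NonZero n}} q → k * n ≤ 2 * q → EqTreeColoring (Kk* k n) q 1
smallClassColouring k n q kn≤2q with q ≤? k * n
... | yes q≤kn =
  let (a , q+a≡kn) = m≤n⇒∃[o]m+o≡n q≤kn
      (b , a+b≡q) = m≤n⇒∃[o]m+o≡n (+-cancelˡ-≤ q a q (subst (_≤ q + q) (sym q+a≡kn) (subst (k * n ≤_) (cong (q +_) (+-identityʳ q)) kn≤2q)))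
  in intervalTreeColouring k n q 1 (L.replicate a 2 ++ L.replicate b 1)
    (trans (length-++ (L.replicate a 2)) (trans (cong₂ _+_ (length-replicate a) (length-replicate b)) a+b≡q))
    (trans (sum-++ (L.replicate a 2) _) (trans (cong₂ _+_ (sum-replicateᴸ a 2) (sum-replicateᴸ b 1))
       (trans (regroup a b) (trans (cong (_+ a) a+b≡q) q+a≡kn))))
    (++⁺ (replicate⁺ a (inj₂ refl)) (replicate⁺ b (inj₁ refl)))
    (LongInsideParts-short n 0 _ (++⁺ (replicate⁺ a ≤-refl) (replicate⁺ b (s≤s z≤n))))
  where
  regroup : ∀ a b → a * 2 + b * 1 ≡ a + b + a
  regroup = solve-∀
... | no q≰kn =
  let (a , kn+a≡q) = m≤n⇒∃[o]m+o≡n (<⇒≤ (≰⇒> q≰kn))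
  in intervalTreeColouring k n q 0 (L.replicate (k * n) 1 ++ L.replicate a 0)
    (trans (length-++ (L.replicate (k * n) 1)) (trans (cong₂ _+_ (length-replicate (k * n)) (length-replicate a)) kn+a≡q))
    (trans (sum-++ (L.replicate (k * n) 1) _) (trans (cong₂ _+_ (sum-replicateᴸ (k * n) 1) (sum-replicateᴸ a 0))
       (trans (cong₂ _+_ (*-identityʳ (k * n)) (*-zeroʳ a)) (+-identityʳ _))))
    (++⁺ (replicate⁺ (k * n) (inj₂ refl)) (replicate⁺ a (inj₁ refl)))
    (LongInsideParts-short n 0 _ (++⁺ (replicate⁺ (k * n) (s≤s z≤n)) (replicate⁺ a z≤n)))


balancedSplit : ℕ → ℕ → ℕ → List ℕ
balancedSplit t s n = L.replicate (n ∸ t * s) (suc s) ++ L.replicate (t ∸ (n ∸ t * s)) s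

balancedSplit-props : ∀ t s n → t * s ≤ n → n ≤ t * suc s →
  length (balancedSplit t s n) ≡ t × sum (balancedSplit t s n) ≡ n × All (EqSize s) (balancedSplit t s n)
balancedSplit-props t s n p q =
  let (a , ea) = m≤n⇒∃[o]m+o≡n p in
  let a≤t : a ≤ t
      a≤t = +-cancelˡ-≤ (t * s) a t (subst (_≤ t * s + t) (sym ea) (subst (n ≤_) (trans (*-suc t s) (+-comm t (t * s))) q)) in
  let (b , eb) = m≤n⇒∃[o]m+o≡n a≤t in
  let na : n ∸ t * s ≡ a
      na = trans (cong (_∸ t * s) (sym ea)) (m+n∸m≡n (t * s) a) in
  let tb : t ∸ (n ∸ t * s) ≡ b
      tb = trans (cong (t ∸_) na) (trans (cong (_∸ a) (sym eb)) (m+n∸m≡n a b)) in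
  (trans (length-++ (L.replicate (n ∸ t * s) (suc s))) (trans (cong₂ _+_ (length-replicate (n ∸ t * s)) (length-replicate (t ∸ (n ∸ t * s))))
     (trans (cong₂ _+_ na tb) eb))) ,
  trans (sum-++ (L.replicate (n ∸ t * s) (suc s)) _) (trans (cong₂ _+_ (sum-replicateᴸ (n ∸ t * s) (suc s)) (sum-replicateᴸ (t ∸ (n ∸ t * s)) s))
     (trans (cong₂ (λ x y → x * suc s + y * s) na tb) (trans (r2 a b s) (trans (cong (λ t → t * s + a) eb) ea)))) ,
  ++⁺ (replicate⁺ (n ∸ t * s) (inj₂ refl)) (replicate⁺ (t ∸ (n ∸ t * s)) (inj₁ refl))
  where
  r2 : ∀ a b s → a * suc s + b * s ≡ (a + b) * s + a
  r2 = solve-∀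

repeat : ℕ → List ℕ → List ℕ
repeat zero B = []
repeat (suc i) B = B ++ repeat i B

length-repeat : ∀ i B → length (repeat i B) ≡ i * length B
length-repeat zero B = refl
length-repeat (suc i) B = trans (length-++ B) (cong (length B +_) (length-repeat i B))

sum-repeat : ∀ i B → sum (repeat i B) ≡ i * sum B
sum-repeat zero B = refl
sum-repeat (suc i) B = trans (sum-++ B _) (cong (sum B +_) (sum-repeat i B))

All-repeat : ∀ {P : ℕ → Set} i B → All P B → All P (repeat i B)
All-repeat zero B a = []
All-repeat (suc i) B a = ++⁺ a (All-repeat i B a)

LongInsideParts-repeat : ∀ n i p B → sum B ≡ n → LongInsideParts n (p * n) (repeat i B)
LongInsideParts-repeat n zero p B e = tt
LongInsideParts-repeat n (suc i) p B e = LongInsideParts-++ n (p * n) B (repeat i B)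
  (LongInsideParts-inPart n p (p * n) B ≤-refl (≤-reflexive (cong (p * n +_) e)))
  (subst (λ t → LongInsideParts n t (repeat i B)) (trans (+-comm n (p * n)) (cong (p * n +_) (sym e))) (LongInsideParts-repeat n i (suc p) B e))

partwiseColouring′ : ∀ k n .{{_ : NonZero n}} q s j i B1 B0 → sum B1 ≡ n → sum B0 ≡ n → All (EqSize s) B1 → All (EqSize s) B0 →
  j + i ≡ k → j * length B1 + i * length B0 ≡ q → EqTreeColoring (Kk* k n) q 1
partwiseColouring′ k n q s j i B1 B0 e1 e0 a1 a0 ek eq =
  intervalTreeColouring k n q s (repeat j B1 ++ repeat i B0)
    (trans (length-++ (repeat j B1)) (trans (cong₂ _+_ (length-repeat j B1) (length-repeat i B0)) eq))
    (trans (sum-++ (repeat j B1) _) (trans (cong₂ _+_ (sum-repeat j B1) (sum-repeat i B0))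
       (trans (cong₂ (λ x y → j * x + i * y) e1 e0) (trans (sym (*-distribʳ-+ n j i)) (cong (_* n) ek)))))
    (++⁺ (All-repeat j B1 a1) (All-repeat i B0 a0))
    (LongInsideParts-++ n 0 (repeat j B1) (repeat i B0) (LongInsideParts-repeat n j 0 B1 e1)
       (subst (λ t → LongInsideParts n t (repeat i B0)) (sym (sum-repeat j B1 ∙ cong (j *_) e1)) (LongInsideParts-repeat n i j B0 e0)))
  where _∙_ = trans

partwiseColouring : ∀ k n .{{_ : NonZero n}} m j s → j ≤ k → m * s ≤ n → n ≤ m * suc s →
  (j ≡ 0 ⊎ (suc m * s ≤ n × n ≤ suc m * suc s)) → EqTreeColoring (Kk* k n) (k * m + j) 1
partwiseColouring k n m j s jk p q (inj₁ refl) =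
  let (l0 , s0 , a0) = balancedSplit-props m s n p q in
  partwiseColouring′ k n (k * m + 0) s 0 k (balancedSplit m s n) (balancedSplit m s n) s0 s0 a0 a0 refl
    (trans (cong (k *_) l0) (sym (+-identityʳ (k * m))))
partwiseColouring k n m j s jk p q (inj₂ (p1 , q1)) =
  let (l0 , s0 , a0) = balancedSplit-props m s n p q in
  let (l1 , s1 , a1) = balancedSplit-props (suc m) s n p1 q1 in
  let (i , ei) = m≤n⇒∃[o]m+o≡n jk in
  partwiseColouring′ k n (k * m + j) s j i (balancedSplit (suc m) s n) (balancedSplit m s n) s1 s0 a1 a0 ei
    (trans (cong₂ (λ x y → j * x + i * y) l1 l0) (trans (r j i m) (cong (λ t → t * m + j) ei)))
  where
  r : ∀ j i m → j * suc m + i * m ≡ (j + i) * m + j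
  r = solve-∀


count3 : List ℕ → ℕ
count3 [] = 0
count3 (x ∷ L) = 𝟙 (x ≡ᵇ 3) + count3 L

count3-++ : ∀ L1 L2 → count3 (L1 ++ L2) ≡ count3 L1 + count3 L2
count3-++ [] L2 = refl
count3-++ (x ∷ L1) L2 = trans (cong (𝟙 (x ≡ᵇ 3) +_) (count3-++ L1 L2)) (sym (+-assoc (𝟙 (x ≡ᵇ 3)) _ _))

count3-replicate3 : ∀ a → count3 (L.replicate a 3) ≡ a
count3-replicate3 zero = refl
count3-replicate3 (suc a) = cong suc (count3-replicate3 a)

count3-replicate2 : ∀ a → count3 (L.replicate a 2) ≡ 0
count3-replicate2 zero = refl
count3-replicate2 (suc a) = count3-replicate2 a

sum≡2*length+count3 : ∀ L → All (EqSize 2) L → sum L ≡ 2 * length L + count3 L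
sum≡2*length+count3 [] [] = refl
sum≡2*length+count3 (x ∷ L) (inj₁ refl ∷ a) = trans (cong (2 +_) (sum≡2*length+count3 L a)) (r (length L) (count3 L))
  where r : ∀ l c → 2 + (2 * l + c) ≡ 2 * suc l + (0 + c)
        r = solve-∀
sum≡2*length+count3 (x ∷ L) (inj₂ refl ∷ a) = trans (cong (3 +_) (sum≡2*length+count3 L a)) (r (length L) (count3 L))
  where r : ∀ l c → 3 + (2 * l + c) ≡ 2 * suc l + (1 + c)
        r = solve-∀

-- Layout n k o R p: classes of sizes 2 and 3 covering the k consecutive parts
-- p, p + 1, …, p + k − 1 of size n, except for the first o vertices, with R classes of
-- size 3, each lying inside one part.
record Layout (n k o R p : ℕ) : Set where
  field
    L : List ℕ
    sizes : All (EqSize 2) L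
    covers : sum L + o ≡ k * n
    triples : count3 L ≡ R
    long : LongInsideParts n (p * n + o) L

-- pad 1 is the pair joining the last vertex of a part to the first vertex of the next.
pad : ℕ → List ℕ → List ℕ
pad zero L = L
pad (suc _) L = 2 ∷ L

EqSize-pad : ∀ d L → All (EqSize 2) L → All (EqSize 2) (pad d L)
EqSize-pad zero L a = a
EqSize-pad (suc _) L a = inj₁ refl ∷ a

sum-pad : ∀ d L → d ≤ 1 → sum (pad d L) ≡ 2 * d + sum L
sum-pad zero L _ = refl
sum-pad (suc zero) L _ = refl
sum-pad (suc (suc _)) L (s≤s ())

count3-pad : ∀ d L → count3 (pad d L) ≡ count3 L
count3-pad zero L = refl
count3-pad (suc _) L = refl

LongInsideParts-pad : ∀ n P d L → d ≤ 1 → LongInsideParts n (P + 2 * d) L → LongInsideParts n P (pad d L)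
LongInsideParts-pad n P zero L _ g = subst (λ t → LongInsideParts n t L) (+-identityʳ P) g
LongInsideParts-pad n P (suc zero) L _ g = (λ q → ⊥-elim (<-irrefl refl (≤-trans q (s≤s (s≤s z≤n))))) , g
LongInsideParts-pad n P (suc (suc _)) L (s≤s ()) g

Layout-empty : ∀ n p → Layout n 0 0 0 p
Layout-empty n p = record { L = [] ; sizes = [] ; covers = refl ; triples = refl ; long = tt }

Layout-subst : ∀ {n k o R R′ p} → R ≡ R′ → Layout n k o R p → Layout n k o R′ p
Layout-subst refl b = b

Layout-cons : ∀ n k p o a c d R′ → d ≤ 1 → o + 3 * a + 2 * c + d ≡ n → Layout n k d R′ (suc p) → Layout n (suc k) o (a + R′) p
Layout-cons .(o + 3 * a + 2 * c + d) k p o a c d R′ dle refl rest = record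
  { L = A ++ pad d L′
  ; sizes = ++⁺ (++⁺ (replicate⁺ a (inj₂ refl)) (replicate⁺ c (inj₁ refl))) (EqSize-pad d L′ (Layout.sizes rest))
  ; covers = trans (cong (_+ o) (trans (sum-++ A (pad d L′)) (cong₂ _+_ sA (sum-pad d L′ dle))))
             (trans (r1 (sum L′)) (cong (n +_) (Layout.covers rest)))
  ; triples = trans (count3-++ A (pad d L′))
             (cong₂ _+_ (trans (count3-++ (L.replicate a 3) _) (trans (cong₂ _+_ (count3-replicate3 a) (count3-replicate2 c)) (+-identityʳ a)))
                        (trans (count3-pad d L′) (Layout.triples rest)))
  ; long = LongInsideParts-++ n (p * n + o) A (pad d L′)
      (LongInsideParts-inPart n p (p * n + o) A (m≤m+n (p * n) o) (m+o≡n⇒m≤n d (r2 (p * n))))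
      (LongInsideParts-pad n (p * n + o + sum A) d L′ dle (subst (λ t → LongInsideParts n t L′) (r3 (p * n)) (Layout.long rest)))
  }
  where
  n = o + 3 * a + 2 * c + d
  L′ = Layout.L rest
  A = L.replicate a 3 ++ L.replicate c 2
  sA : sum A ≡ a * 3 + c * 2
  sA = trans (sum-++ (L.replicate a 3) _) (cong₂ _+_ (sum-replicateᴸ a 3) (sum-replicateᴸ c 2))
  r1 : ∀ X → a * 3 + c * 2 + (2 * d + X) + o ≡ n + (X + d)
  r1 X = lem o a c d X
    where lem : ∀ o a c d X → a * 3 + c * 2 + (2 * d + X) + o ≡ o + 3 * a + 2 * c + d + (X + d)
          lem = solve-∀
  r2 : ∀ pn → pn + o + sum A + d ≡ pn + n
  r2 pn rewrite sA = lem pn o a c d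
    where lem : ∀ pn o a c d → pn + o + (a * 3 + c * 2) + d ≡ pn + (o + 3 * a + 2 * c + d)
          lem = solve-∀
  r3 : ∀ pn → n + pn + d ≡ pn + o + sum A + 2 * d
  r3 pn rewrite sA = lem pn o a c d
    where lem : ∀ pn o a c d → o + 3 * a + 2 * c + d + pn + d ≡ pn + o + (a * 3 + c * 2) + 2 * d
          lem = solve-∀

leftover-even : ∀ M c d T x → M + (2 * c + d) ≡ T + 2 * x → d + T ≤ M → Σ ℕ λ x′ → M ≡ d + T + 2 * x′
leftover-even M c d T x eq le with m≤n⇒∃[o]m+o≡n le
... | (y , refl) = x ∸ (c + d) , cong (d + T +_) (even-difference y (c + d) x
       (+-cancelˡ-≡ T _ _ (trans (r d T y c) eq)))
  where r : ∀ d T y c → T + (y + 2 * (c + d)) ≡ d + T + y + (2 * c + d)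
        r = solve-∀

leftover : ∀ n M o a c d R′ x → o + 3 * a + 2 * c + d ≡ n → n + M ≡ o + 3 * (a + R′) + 2 * x → M + (2 * c + d) ≡ 3 * R′ + 2 * x
leftover .(o + 3 * a + 2 * c + d) M o a c d R′ x refl eq =
  +-cancelˡ-≡ (o + 3 * a) _ _ (trans (r1 o a c d M) (trans eq (r2 o a R′ x)))
  where r1 : ∀ o a c d M → o + 3 * a + (M + (2 * c + d)) ≡ o + 3 * a + 2 * c + d + M
        r1 = solve-∀
        r2 : ∀ o a R′ x → o + 3 * (a + R′) + 2 * x ≡ o + 3 * a + (3 * R′ + 2 * x)
        r2 = solve-∀

-- The invariant of the greedy layout: k parts of size n = 3 b′ + e, minus their first
-- o vertices, are to hold R triples and some number of pairs.  When a part of size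
-- 3 b′ has lost a vertex, no triple is left to place.
record LayoutBudget (n b′ e k o R : ℕ) : Set where
  field
    o≤1 : o ≤ 1
    R≤kb′ : R ≤ k * b′
    o≡1∧e≡0⇒R≡0 : o ≡ 1 → e ≡ 0 → R ≡ 0
    pairs : ℕ
    total : k * n ≡ o + 3 * R + 2 * pairs

split-part : ∀ n o a → o + 3 * a ≤ n → Σ ℕ λ c → Σ ℕ λ d → d ≤ 1 × n ∸ (o + 3 * a) ≡ 2 * c + d × o + 3 * a + 2 * c + d ≡ n
split-part n o a fit =
  let (c , d , d≤1 , rest≡) = divMod2 (n ∸ (o + 3 * a)) in
  c , d , d≤1 , rest≡ , trans (+-assoc (o + 3 * a) (2 * c) d) (trans (cong (o + 3 * a +_) (sym rest≡)) (m+[n∸m]≡n fit))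

layout-step-all : ∀ {n b′ e k o R} → n ≡ 3 * b′ + e → 1 ≤ n → R ≤ b′ → LayoutBudget n b′ e (suc (suc k)) o R →
  Σ ℕ λ c → Σ ℕ λ d → o + 3 * R + 2 * c + d ≡ n × LayoutBudget n b′ e (suc k) d 0
layout-step-all {n} {b′} {e} {k} {o} {R} n≡ n≥1 R≤b′ budget =
  let (c , d , d≤1 , _ , split) = split-part n o R (fit o≤1)
      (x′ , total′) = leftover-even (suc k * n) c d (3 * 0) pairs
        (leftover n (suc k * n) o R c d 0 pairs split (trans total (cong (λ t → o + 3 * t + 2 * pairs) (sym (+-identityʳ R)))))
        (≤-trans (≤-reflexive (+-identityʳ d)) (≤-trans d≤1 (≤-trans n≥1 (m≤m+n n (k * n)))))
  in c , d , split , record { o≤1 = d≤1 ; R≤kb′ = z≤n ; o≡1∧e≡0⇒R≡0 = λ _ _ → refl ; pairs = x′ ; total = total′ }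
  where
  open LayoutBudget budget
  fit : o ≤ 1 → o + 3 * R ≤ n
  fit z≤n = ≤-trans (*-monoʳ-≤ 3 R≤b′) (≤-trans (m≤m+n (3 * b′) e) (≤-reflexive (sym n≡)))
  fit (s≤s z≤n) with e ≟ 0
  ... | yes e≡0 = subst (λ t → 1 + 3 * t ≤ n) (sym (o≡1∧e≡0⇒R≡0 refl e≡0)) n≥1
  ... | no e≢0 = ≤-trans (s≤s (*-monoʳ-≤ 3 R≤b′))
        (≤-trans (≤-reflexive (+-comm 1 (3 * b′))) (≤-trans (+-monoʳ-≤ (3 * b′) (n≢0⇒n>0 e≢0)) (≤-reflexive (sym n≡))))

layout-step-full : ∀ {n b′ e k o R} → n ≡ 3 * b′ + e → b′ < R → LayoutBudget n b′ e (suc (suc k)) o R →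
  Σ ℕ λ c → Σ ℕ λ d → Σ ℕ λ R′ → o + 3 * b′ + 2 * c + d ≡ n × b′ + R′ ≡ R × LayoutBudget n b′ e (suc k) d R′
layout-step-full {n} {b′} {e} {k} {o} {R} n≡ b′<R budget =
  let (c , d , d≤1 , rest≡ , split) = split-part n o b′ fit
      (R′ , R≡) = m≤n⇒∃[o]m+o≡n (<⇒≤ b′<R)
      R′≤ : R′ ≤ suc k * b′
      R′≤ = +-cancelˡ-≤ b′ R′ (suc k * b′) (subst (_≤ suc (suc k) * b′) (sym R≡) R≤kb′)
      (x′ , total′) = leftover-even (suc k * n) c d (3 * R′) pairs
        (leftover n (suc k * n) o b′ c d R′ pairs split (trans total (cong (λ t → o + 3 * t + 2 * pairs) (sym R≡))))
        (≤-trans (+-mono-≤ (d≤ke c d d≤1 rest≡) (*-monoʳ-≤ 3 R′≤)) (≤-reflexive (kn-split k {b′} {e} n≡)))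
  in c , d , R′ , split , R≡ , record
       { o≤1 = d≤1 ; R≤kb′ = R′≤ ; pairs = x′ ; total = total′
       ; o≡1∧e≡0⇒R≡0 = λ d≡1 e≡0 → ⊥-elim (0≢1+n (trans (sym (e≡0⇒d≡0 c d rest≡ e≡0)) d≡1)) }
  where
  open LayoutBudget budget
  o≤e : o ≤ e
  o≤e with o≤1
  ... | z≤n = z≤n
  ... | s≤s z≤n with e ≟ 0
  ...   | yes e≡0 = ⊥-elim (<⇒≱ b′<R (subst (_≤ b′) (sym (o≡1∧e≡0⇒R≡0 refl e≡0)) z≤n))
  ...   | no e≢0 = n≢0⇒n>0 e≢0
  fit : o + 3 * b′ ≤ n
  fit = ≤-trans (≤-reflexive (+-comm o (3 * b′))) (≤-trans (+-monoʳ-≤ (3 * b′) o≤e) (≤-reflexive (sym n≡)))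
  e≡0⇒d≡0 : ∀ c d → n ∸ (o + 3 * b′) ≡ 2 * c + d → e ≡ 0 → d ≡ 0
  e≡0⇒d≡0 c d rest≡ e≡0 =
    let o≡0 : o ≡ 0
        o≡0 = n≤0⇒n≡0 (subst (o ≤_) e≡0 o≤e)
        nothing-left : n ∸ (o + 3 * b′) ≡ 0
        nothing-left = trans (cong₂ (λ x y → x ∸ (y + 3 * b′)) (trans n≡ (cong (3 * b′ +_) e≡0)) o≡0)
                             (trans (cong (_∸ 3 * b′) (+-identityʳ (3 * b′))) (n∸n≡0 (3 * b′)))
    in m+n≡0⇒n≡0 (2 * c) (trans (sym rest≡) nothing-left)
  d≤ke : ∀ c d → d ≤ 1 → n ∸ (o + 3 * b′) ≡ 2 * c + d → d ≤ suc k * e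
  d≤ke c zero _ rest≡ = z≤n
  d≤ke c (suc zero) _ rest≡ with e ≟ 0
  ... | yes e≡0 = ⊥-elim (0≢1+n (sym (e≡0⇒d≡0 c 1 rest≡ e≡0)))
  ... | no e≢0 = *-mono-≤ (s≤s (z≤n {k})) (n≢0⇒n>0 e≢0)
  d≤ke c (suc (suc _)) (s≤s ()) rest≡
  kn-split : ∀ k {b e n} → n ≡ 3 * b + e → suc k * e + 3 * (suc k * b) ≡ suc k * n
  kn-split k {b} {e} refl = lem k b e
    where lem : ∀ k b e → suc k * e + 3 * (suc k * b) ≡ suc k * (3 * b + e)
          lem = solve-∀

-- Greedily fill each part with as many of the remaining triples as fit.
pairTripleLayout : ∀ n b′ e → n ≡ 3 * b′ + e → 1 ≤ n → ∀ k p o R → LayoutBudget n b′ e (suc k) o R → Layout n (suc k) o R p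
pairTripleLayout n b′ e n≡ n≥1 zero p o R budget =
  Layout-subst (+-identityʳ R) (Layout-cons n 0 p o R pairs 0 0 z≤n
    (trans (+-identityʳ _) (sym (trans (sym (+-identityʳ n)) total))) (Layout-empty n (suc p)))
  where open LayoutBudget budget
pairTripleLayout n b′ e n≡ n≥1 (suc k) p o R budget with R ≤? b′
... | yes R≤b′ =
  let (c , d , split , budget′) = layout-step-all n≡ n≥1 R≤b′ budget in
  Layout-subst (+-identityʳ R) (Layout-cons n (suc k) p o R c d 0 (LayoutBudget.o≤1 budget′) split
    (pairTripleLayout n b′ e n≡ n≥1 k (suc p) d 0 budget′))
... | no R≰b′ =
  let (c , d , R′ , split , R≡ , budget′) = layout-step-full n≡ (≰⇒> R≰b′) budget in
  Layout-subst R≡ (Layout-cons n (suc k) p o b′ c d R′ (LayoutBudget.o≤1 budget′) split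
    (pairTripleLayout n b′ e n≡ n≥1 k (suc p) d R′ budget′))

pairTripleColouring : ∀ k n .{{_ : NonZero n}} q b′ e → n ≡ 3 * b′ + e → 1 ≤ k → 2 * q ≤ k * n → k * n ≤ 3 * q →
        k * n ≤ 2 * q + k * b′ → EqTreeColoring (Kk* k n) q 1
pairTripleColouring (suc k′) n q b′ e n≡ k1 2q≤kn kn≤3q kn≤2q+kb′ =
  let (r , 2q+r≡kn) = m≤n⇒∃[o]m+o≡n 2q≤kn
      r≤q : r ≤ q
      r≤q = +-cancelˡ-≤ (2 * q) r q (≤-trans (≤-reflexive 2q+r≡kn) (≤-trans kn≤3q (≤-reflexive (3q≡2q+q q))))
      (x , r+x≡q) = m≤n⇒∃[o]m+o≡n r≤q
      budget : LayoutBudget n b′ e (suc k′) 0 r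
      budget = record
        { o≤1 = z≤n ; o≡1∧e≡0⇒R≡0 = λ () ; pairs = x
        ; R≤kb′ = +-cancelˡ-≤ (2 * q) r _ (subst (_≤ 2 * q + suc k′ * b′) (sym 2q+r≡kn) kn≤2q+kb′)
        ; total = trans (sym 2q+r≡kn) (trans (cong (λ t → 2 * t + r) (sym r+x≡q)) (regroup r x)) }
      layout = pairTripleLayout n b′ e n≡ (>-nonZero⁻¹ n) k′ 0 0 r budget
      open Layout layout
      sum≡ : sum L ≡ suc k′ * n
      sum≡ = trans (sym (+-identityʳ (sum L))) covers
      length≡ : length L ≡ q
      length≡ = *-cancelˡ-≡ (length L) q 2 (+-cancelʳ-≡ r _ _ (trans (cong (2 * length L +_) (sym triples))
              (trans (sym (sum≡2*length+count3 L sizes)) (trans sum≡ (sym 2q+r≡kn)))))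
  in intervalTreeColouring (suc k′) n q 2 L length≡ sum≡ sizes long
  where
  3q≡2q+q : ∀ q → 3 * q ≡ 2 * q + q
  3q≡2q+q = solve-∀
  regroup : ∀ r x → 2 * (r + x) + r ≡ 0 + 3 * r + 2 * x
  regroup = solve-∀

colouring-above-pairTriple : ∀ k n b r p .{{_ : NonZero n}} → n ≡ 3 * b + r → 1 ≤ k →
      (∀ q → p ≤ q → k * n ≤ 3 * q × k * n ≤ 2 * q + k * b) → ∀ q → p ≤ q → EqTreeColoring (Kk* k n) q 1
colouring-above-pairTriple k n b r p nb k1 h q le with k * n ≤? 2 * q
... | yes l2 = smallClassColouring k n q l2
... | no l2 = pairTripleColouring k n q b r nb k1 (<⇒≤ (≰⇒> l2)) (proj₁ (h q le)) (proj₂ (h q le))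

-- The classes of a (q, 1)-tree-colouring of K_{k*n}

==-suc : ∀ {m} (a b : Fin m) → (suc a == suc b) ≡ (a == b)
==-suc a b with a F.≟ b | suc a F.≟ suc b
... | yes _ | yes _ = refl
... | no _ | no _ = refl
... | yes p | no q = ⊥-elim (q (cong suc p))
... | no p | yes q = ⊥-elim (p (Fin.suc-injective q))

==-zero-suc : ∀ {m} (a : Fin m) → (zero == suc a) ≡ false
==-zero-suc a = ≢⇒==-false {i = zero} {j = suc a} (λ ())
==-suc-zero : ∀ {m} (a : Fin m) → (suc a == zero) ≡ false
==-suc-zero a = ≢⇒==-false {i = suc a} {j = zero} (λ ())

count-part : ∀ k n (i : Fin k) → count (λ v → partOf (replicate k n) v == i) ≡ n
count-part (suc k) n i =
  trans (∑-splitAt {n} (λ v → 𝟙 (partOf (replicate (suc k) n) v == i)))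
        (trans (cong₂ _+_ (∑-cong {n} (λ v → cong (λ t → 𝟙 (part t == i)) (splitAt-↑ˡ n v _)))
                          (∑-cong {N₀} (λ v → cong (λ t → 𝟙 (part t == i)) (splitAt-↑ʳ n _ v))))
               (first+rest i))
  where
  N₀ = V.sum (replicate k n)
  rest = partOf (replicate k n)
  part : Fin n ⊎ Fin N₀ → Fin (suc k)
  part = [ (λ _ → zero) , (λ j → suc (rest j)) ]′
  first+rest : ∀ i → ∑ {n} (λ _ → 𝟙 (zero == i)) + ∑ {N₀} (λ j → 𝟙 (suc (rest j) == i)) ≡ n
  first+rest zero = trans (cong₂ _+_ (trans (∑-const {n} 1) (*-identityʳ n)) (∑-zero {N₀} _ (λ j → cong 𝟙 (==-suc-zero (rest j)))))
    (+-identityʳ n)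
  first+rest (suc i) = trans (cong₂ _+_ (∑-zero {n} _ (λ _ → cong 𝟙 (==-zero-suc i))) (∑-cong {N₀} (λ j → cong 𝟙 (==-suc (rest j) i))))
    (count-part k n i)

module _ (k n : ℕ) .{{_ : NonZero n}} (q : ℕ) (c : Fin (V.sum (replicate k n)) → Fin q)
         (deg : ∀ v → classDegree (Kk* k n) c v ≤ 1) where

  N₀ = V.sum (replicate k n)
  part = partOf (replicate k n)

  size : Fin q → ℕ
  size j = count (λ v → c v == j)

  classDegree-count : ∀ x → count (λ w → not (part x == part w) ∧ (c w == c x)) ≤ 1
  classDegree-count x = ≤-trans (≤-reflexive (sym (∣tabulate∣≡count {N₀} _))) (deg x)

  ¬twoNeighbours : ∀ x y z → part x ≢ part y → part x ≢ part z → c y ≡ c x → c z ≡ c x → y ≢ z → ⊥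
  ¬twoNeighbours x y z nxy nxz cy cz yz = 1+n≰n (≤-trans (count≥2 {N₀} _ y z (g y nxy cy) (g z nxz cz) yz) (classDegree-count x))
    where
    g : ∀ w → part x ≢ part w → c w ≡ c x → (not (part x == part w) ∧ (c w == c x)) ≡ true
    g w ne e rewrite ≢⇒==-false ne | e | ==-refl (c x) = refl

  -- If x and y lie in different parts, a third member z of their class is adjacent to
  -- one of them, which then has two neighbours in the class.
  bigClass-samePart : ∀ j → 3 ≤ size j → ∀ x y → c x ≡ j → c y ≡ j → part x ≡ part y
  bigClass-samePart j big x y cx cy with part x F.≟ part y
  ... | yes p = p
  ... | no nxy with count≥3⇒third {N₀} (λ v → c v == j) big x y
  ...   | (z , cz , zx , zy) with part z F.≟ part x
  ...     | no nzx = ⊥-elim (¬twoNeighbours x y z nxy (λ e → nzx (sym e)) (trans cy (sym cx)) (trans (==⇒≡ cz) (sym cx)) (λ e → zy (sym e)))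
  ...     | yes zx′ = ⊥-elim (¬twoNeighbours y x z (λ e → nxy (sym e)) (λ e → nxy (sym (trans e zx′))) (trans cx (sym cy)) (trans (==⇒≡ cz) (sym cy)) (λ e → zx (sym e)))

  nonemptyClass-witness : ∀ j → 1 ≤ size j → Σ (Fin N₀) λ v → c v ≡ j
  nonemptyClass-witness j p = let (v , q) = ∑-pos {N₀} (λ v → 𝟙 (c v == j)) p in v , ==⇒≡ (𝟙-pos _ q)

  -- The part containing class j when j is big; dflt is an arbitrary choice otherwise.
  classPart : Fin k → Fin q → Fin k
  classPart dflt j with 1 ≤? size j
  ... | yes p = part (proj₁ (nonemptyClass-witness j p))
  ... | no _ = dflt

  classPart-member : ∀ dflt j → 3 ≤ size j → ∀ x → c x ≡ j → part x ≡ classPart dflt j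
  classPart-member dflt j big x cx with 1 ≤? size j
  ... | yes p = bigClass-samePart j big x (proj₁ (nonemptyClass-witness j p)) cx (proj₂ (nonemptyClass-witness j p))
  ... | no np = ⊥-elim (np (≤-trans (s≤s z≤n) big))

  count-class∩part : ∀ dflt j i → 3 ≤ size j → ∑ {N₀} (λ v → 𝟙 (c v == j) * 𝟙 (part v == i)) ≡ 𝟙 (classPart dflt j == i) * size j
  count-class∩part dflt j i big = trans (∑-cong {N₀} pw) (∑-*ˡ {N₀} (𝟙 (classPart dflt j == i)) _)
    where
    pw : ∀ v → 𝟙 (c v == j) * 𝟙 (part v == i) ≡ 𝟙 (classPart dflt j == i) * 𝟙 (c v == j)
    pw v with c v == j in e
    ... | false = sym (*-zeroʳ (𝟙 (classPart dflt j == i)))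
    ... | true rewrite classPart-member dflt j big v (==⇒≡ e) = trans (+-identityʳ _) (sym (*-identityʳ _))

  part-by-classes : ∀ i → n ≡ ∑ (λ j → ∑ {N₀} (λ v → 𝟙 (c v == j) * 𝟙 (part v == i)))
  part-by-classes i = trans (sym (count-part k n i)) (∑-fibres c (λ v → 𝟙 (part v == i)))

  isBig : Fin q → ℕ
  isBig j = 𝟙 (does (3 ≤? size j))

  isBig-yes : ∀ j → 3 ≤ size j → isBig j ≡ 1
  isBig-yes j p = cong 𝟙 (dec-true (3 ≤? size j) p)
  isBig-no : ∀ j → ¬ 3 ≤ size j → isBig j ≡ 0
  isBig-no j p = cong 𝟙 (dec-false (3 ≤? size j) p)

  bigClasses-in-part≤n : ∀ dflt i → ∑ (λ j → isBig j * (𝟙 (classPart dflt j == i) * size j)) ≤ n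
  bigClasses-in-part≤n dflt i = ≤-trans (∑-mono-≤ {q} pw) (≤-reflexive (sym (part-by-classes i)))
    where
    pw : ∀ j → isBig j * (𝟙 (classPart dflt j == i) * size j) ≤ ∑ {N₀} (λ v → 𝟙 (c v == j) * 𝟙 (part v == i))
    pw j with 3 ≤? size j
    ... | yes big rewrite isBig-yes j big = ≤-reflexive (trans (+-identityʳ _) (sym (count-class∩part dflt j i big)))
    ... | no nb rewrite isBig-no j nb = z≤n

  part≡classes : ∀ dflt → (∀ j → 3 ≤ size j) → ∀ i → ∑ (λ j → 𝟙 (classPart dflt j == i) * size j) ≡ n
  part≡classes dflt all i = trans (∑-cong {q} (λ j → sym (count-class∩part dflt j i (all j)))) (sym (part-by-classes i))

  ∑size≡N : ∑ size ≡ N₀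
  ∑size≡N = sym (trans (sym (trans (∑-const {N₀} 1) (*-identityʳ N₀))) (trans (∑-fibres c (λ _ → 1))
            (∑-cong {q} (λ j → ∑-cong {N₀} (λ v → *-identityʳ _)))))

  -- A class has at most 2 vertices, plus 1 when it is big, and a part contains at most
  -- n / 3 big classes.
  N≤2q+k⌊n/3⌋ : Fin k → (∀ j → size j ≤ 3) → N₀ ≤ 2 * q + k * (n / 3)
  N≤2q+k⌊n/3⌋ dflt le3 = ≤-trans (≤-reflexive (sym ∑size≡N)) (≤-trans (∑-mono-≤ {q} {g = λ j → 2 + isBig j} pw)
     (≤-trans (≤-reflexive (trans (∑-distrib-+ {q} (λ _ → 2) isBig) (cong (_+ ∑ isBig) (trans (∑-const {q} 2) (*-comm q 2)))))
       (+-monoʳ-≤ (2 * q) (≤-trans (≤-reflexive (∑-fibres (classPart dflt) isBig))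
          (≤-trans (∑-mono-≤ {k} {g = λ _ → n / 3} perPart) (≤-reflexive (∑-const {k} (n / 3))))))))
    where
    pw : ∀ j → size j ≤ 2 + isBig j
    pw j with 3 ≤? size j
    ... | yes big rewrite isBig-yes j big = le3 j
    ... | no nb rewrite isBig-no j nb = ≤-pred (≰⇒> nb)
    perPart : ∀ i → ∑ (λ j → 𝟙 (classPart dflt j == i) * isBig j) ≤ n / 3
    perPart i = 3*x≤m⇒x≤m/3 _ n (≤-trans (≤-reflexive (sym (∑-*ˡ {q} 3 _))) (≤-trans (∑-mono-≤ {q} pw2) (bigClasses-in-part≤n dflt i)))
      where
      pw2 : ∀ j → 3 * (𝟙 (classPart dflt j == i) * isBig j) ≤ isBig j * (𝟙 (classPart dflt j == i) * size j)
      pw2 j with 3 ≤? size j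
      ... | no nb rewrite isBig-no j nb = ≤-reflexive (cong (3 *_) (*-zeroʳ (𝟙 (classPart dflt j == i))))
      ... | yes big rewrite isBig-yes j big with classPart dflt j == i
      ...   | false = z≤n
      ...   | true = ≤-trans big (≤-reflexive (sym (trans (+-identityʳ _) (+-identityʳ _))))

  -- t i is the number of classes inside part i, and u i the number of those of size 1 + s.
  partsAreUnionsOfClasses : Fin k → ∀ s → (∀ j → size j ≡ s ⊎ size j ≡ suc s) → (∀ j → 3 ≤ size j) →
    Σ (Fin k → ℕ) λ t → Σ (Fin k → ℕ) λ u →
      (∀ i → n ≡ s * t i + u i × u i ≤ t i) × ∑ t ≡ q × N₀ ≡ s * q + ∑ u
  partsAreUnionsOfClasses dflt s sizes big = t , u , part-split , ∑t≡q , N≡sq+∑u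
    where
    large : Fin q → ℕ
    large j = 𝟙 (size j ≡ᵇ suc s)
    size≡s+large : ∀ j → size j ≡ s + large j
    size≡s+large j with sizes j
    ... | inj₁ e rewrite e | ≢⇒≡ᵇ-false {s} {suc s} (λ x → 1+n≰n (≤-reflexive (sym x))) = sym (+-identityʳ s)
    ... | inj₂ e rewrite e | ≡ᵇ-refl (suc s) = +-comm 1 s
    inPart : Fin k → Fin q → ℕ
    inPart i j = 𝟙 (classPart dflt j == i)
    t : Fin k → ℕ
    t i = ∑ (inPart i)
    u : Fin k → ℕ
    u i = ∑ (λ j → inPart i j * large j)
    large≤1 : ∀ j → large j ≤ 1
    large≤1 j = 𝟙≤1 _
    part-split : ∀ i → n ≡ s * t i + u i × u i ≤ t i
    part-split i = trans (sym (part≡classes dflt big i)) (trans (∑-cong {q} (λ j → trans (cong (inPart i j *_) (size≡s+large j)) (r (inPart i j) s (large j))))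
              (trans (∑-distrib-+ {q} _ _) (cong (_+ u i) (∑-*ˡ {q} s (inPart i))))) ,
            ∑-mono-≤ {q} (λ j → ≤-trans (*-monoʳ-≤ (inPart i j) (large≤1 j)) (≤-reflexive (*-identityʳ _)))
      where r : ∀ b s e → b * (s + e) ≡ s * b + b * e
            r = solve-∀
    ∑t≡q : ∑ t ≡ q
    ∑t≡q = sym (trans (sym (trans (∑-const {q} 1) (*-identityʳ q))) (trans (∑-fibres (classPart dflt) (λ _ → 1))
           (∑-cong {k} (λ i → ∑-cong {q} (λ j → *-identityʳ _)))))
    N≡sq+∑u : N₀ ≡ s * q + ∑ u
    N≡sq+∑u = trans (sym ∑size≡N) (trans (∑-cong {q} size≡s+large) (trans (∑-distrib-+ {q} _ _)
           (cong₂ _+_ (trans (∑-const {q} s) (*-comm q s)) (trans (∑-fibres (classPart dflt) large)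
              (∑-cong {k} (λ i → ∑-cong {q} (λ j → refl)))))))

  bigClass≤n : ∀ dflt j → 3 ≤ size j → size j ≤ n
  bigClass≤n dflt j big = ≤-trans (≤-reflexive (sym Fj)) (≤-trans (term≤∑ F j) (bigClasses-in-part≤n dflt (classPart dflt j)))
    where
    F : Fin q → ℕ
    F j′ = isBig j′ * (𝟙 (classPart dflt j′ == classPart dflt j) * size j′)
    Fj : F j ≡ size j
    Fj rewrite isBig-yes j big | ==-refl (classPart dflt j) = trans (+-identityʳ _) (+-identityʳ _)

-- Lower bounds

IsVA-intro : ∀ G p → 1 ≤ p → (∀ q → p ≤ q → EqTreeColoring G q 1) → ¬ EqTreeColoring G (pred p) 1 → IsVA G 1 p
IsVA-intro G (suc p0) _ ub nc = ub , lb
  where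
  lb : ∀ p′ → AllAbove G 1 p′ → suc p0 ≤ p′
  lb p′ all with suc p0 ≤? p′
  ... | yes le = le
  ... | no nle = ⊥-elim (nc (all p0 (≤-pred (≰⇒> nle))))

¬colouring-zero : ∀ G r → 0 < N G → ¬ EqTreeColoring G 0 r
¬colouring-zero G r p (c , _) with c (fromℕ< p)
... | ()

classSize≡size : ∀ k n .{{_ : NonZero n}} q (c : Fin (V.sum (replicate k n)) → Fin q) j → classSize (Kk* k n) c j ≡ count (λ v → c v == j)
classSize≡size k n q c j = ∣tabulate∣≡count {V.sum (replicate k n)} (λ v → c v == j)

N>0 : ∀ k n → 1 ≤ k → 1 ≤ n → 0 < V.sum (replicate k n)
N>0 (suc k) (suc n) _ _ = s≤s z≤n

-- Either hypothesis bounds the class sizes by 3: through ⌈kn/q⌉, or because a class of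
-- size 3 would lie inside a part of size at most 2.
colouring⇒N≤2q+k⌊n/3⌋ : ∀ k n .{{_ : NonZero n}} q → 1 ≤ k → EqTreeColoring (Kk* k n) q 1 → (k * n ≤ 3 * q ⊎ n ≤ 2) →
        k * n ≤ 2 * q + k * (n / 3)
colouring⇒N≤2q+k⌊n/3⌋ k n zero k1 col _ = ⊥-elim (¬colouring-zero (Kk* k n) 1 (N>0 k n k1 (>-nonZero⁻¹ n)) col)
colouring⇒N≤2q+k⌊n/3⌋ (suc k′) n (suc q′) k1 (c , eqc , _ , deg) h =
  subst (_≤ 2 * suc q′ + suc k′ * (n / 3)) (sum-replicate (suc k′) n) (N≤2q+k⌊n/3⌋ (suc k′) n (suc q′) c deg zero (le3 h))
  where
  NK = V.sum (replicate (suc k′) n)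
  le3 : (suc k′ * n ≤ 3 * suc q′ ⊎ n ≤ 2) → ∀ j → size (suc k′) n (suc q′) c deg j ≤ 3
  le3 (inj₁ l) j =
    let cl : (NK + q′) / suc q′ ≤ 3
        cl = ≤-pred (m<n*o⇒m/o<n (≤-trans (s≤s (+-monoˡ-≤ q′ (≤-trans (≤-reflexive (sum-replicate (suc k′) n)) l))) (≤-reflexive (r q′)))) in
    [ (λ e → ≤-trans (≤-reflexive (trans (sym (classSize≡size (suc k′) n (suc q′) c j)) e)) (≤-trans (/-monoˡ-≤ (suc q′) (m≤m+n NK q′)) cl)) ,
      (λ e → ≤-trans (≤-reflexive (trans (sym (classSize≡size (suc k′) n (suc q′) c j)) e)) cl) ]′ (eqc j)
    where
    r : ∀ q → suc (3 * suc q + q) ≡ 4 * suc q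
    r = solve-∀
  le3 (inj₂ n2) j with 3 ≤? size (suc k′) n (suc q′) c deg j
  ...   | no nb = ≤-trans (≤-pred (≰⇒> nb)) (n≤1+n 2)
  ...   | yes big = ⊥-elim (1+n≰n (≤-trans big (≤-trans (bigClass≤n (suc k′) n (suc q′) c deg zero j big) n2)))

-- When ⌊kn/q⌋ ≥ 3 every class is big, so every part is a union of classes.
colouring⇒partDecomposition : ∀ k n .{{_ : NonZero n}} q′ → 1 ≤ k → EqTreeColoring (Kk* k n) (suc q′) 1 → 3 * suc q′ ≤ k * n →
  Σ (Fin k → ℕ) λ t → Σ (Fin k → ℕ) λ u →
    (∀ i → n ≡ (k * n) / suc q′ * t i + u i × u i ≤ t i) × ∑ t ≡ suc q′ × k * n ≡ (k * n) / suc q′ * suc q′ + ∑ u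
colouring⇒partDecomposition (suc k′) n q′ k1 (c , eqc , _ , deg) l3 =
  subst P (sum-replicate (suc k′) n) (partsAreUnionsOfClasses (suc k′) n (suc q′) c deg zero s two all)
  where
  NK = V.sum (replicate (suc k′) n)
  s = NK / suc q′
  P : ℕ → Set
  P M = Σ (Fin (suc k′) → ℕ) λ t → Σ (Fin (suc k′) → ℕ) λ u →
    (∀ i → n ≡ M / suc q′ * t i + u i × u i ≤ t i) × ∑ t ≡ suc q′ × M ≡ M / suc q′ * suc q′ + ∑ u
  two : ∀ j → size (suc k′) n (suc q′) c deg j ≡ s ⊎ size (suc k′) n (suc q′) c deg j ≡ suc s
  two j with eqc j
  ... | inj₁ e = inj₁ (trans (sym (classSize≡size (suc k′) n (suc q′) c j)) e)
  ... | inj₂ e = ⊎map (trans (trans (sym (classSize≡size (suc k′) n (suc q′) c j)) e)) (trans (trans (sym (classSize≡size (suc k′) n (suc q′) c j)) e)) (ceil≡floor⊎suc-floor NK q′)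
  s3 : 3 ≤ s
  s3 = ≤-trans (≤-reflexive (sym (m*n/n≡m 3 (suc q′)))) (/-monoˡ-≤ (suc q′) (≤-trans l3 (≤-reflexive (sym (sum-replicate (suc k′) n)))))
  all : ∀ j → 3 ≤ size (suc k′) n (suc q′) c deg j
  all j with two j
  ... | inj₁ e = ≤-trans s3 (≤-reflexive (sym e))
  ... | inj₂ e = ≤-trans s3 (≤-trans (n≤1+n s) (≤-reflexive (sym e)))

-- Here ⌊kn/q⌋ = 3 and exactly one class has size 4, so some part is a union of classes
-- of size 3, although 3 ∤ n.
¬colouring-3q+1 : ∀ k′ n b r q′ .{{_ : NonZero n}} → n ≡ 3 * b + r → 0 < r → r < 3 →
  EqTreeColoring (Kk* (suc (suc k′)) n) (suc q′) 1 → suc (suc k′) * n ≡ 3 * suc q′ + 1 → suc (suc k′) * n < 3 * suc q′ + suc q′ → ⊥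
¬colouring-3q+1 k′ n b r q′ nb r0 r3 col eq lt =
  let (t , u , h , st , nq) = colouring⇒partDecomposition KK n q′ (s≤s z≤n) col l3 in finish t u h nq
  where
  KK = suc (suc k′)
  l3 : 3 * suc q′ ≤ KK * n
  l3 = ≤-trans (m≤m+n _ 1) (≤-reflexive (sym eq))
  sEq : (KK * n) / suc q′ ≡ 3
  sEq = /-unique (KK * n) (suc q′) 3 l3 lt
  finish : (t u : Fin KK → ℕ) → (∀ i → n ≡ (KK * n) / suc q′ * t i + u i × u i ≤ t i) →
           KK * n ≡ (KK * n) / suc q′ * suc q′ + ∑ u → ⊥
  finish t u h nq = [ fin zero , fin (suc zero) ]′ (∑≤1⇒zero-at-0-or-1 u (≤-reflexive su))
    where
    nq′ : KK * n ≡ 3 * suc q′ + ∑ u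
    nq′ = trans nq (cong (λ x → x * suc q′ + ∑ u) sEq)
    su : ∑ u ≡ 1
    su = +-cancelˡ-≡ (3 * suc q′) (∑ u) 1 (trans (sym nq′) eq)
    fin : ∀ i → u i ≡ 0 → ⊥
    fin i u0 = 3t≢3b+r (t i) b r r0 r3 (sym (trans (sym nb) (trans (proj₁ (h i))
                 (trans (cong₂ (λ x y → x * t i + y) sEq u0) (+-identityʳ _)))))

-- The value p(q : k*n)

-- Some part holds fewer than 1 + m′ classes, which forces d ≤ s; another holds at
-- least 1 + m′, which forces (1 + m′) s ≤ n.
balancedParts⇒exact : ∀ {k} n s m′ d (t u : Fin k → ℕ) → (∀ i → n ≡ s * t i + u i × u i ≤ t i) →
  ∑ t < k * suc m′ → k * m′ < ∑ t → m′ * d < n → n ≤ suc m′ * d → n ≡ suc m′ * d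
balancedParts⇒exact n s m′ d t u parts few many below above =
  let (i , tᵢ≤m′) = ∑<k*m⇒small-term t (suc m′) few
      (i′ , m′<tᵢ′) = k*m<∑⇒big-term t m′ many
      (n≡ᵢ , uᵢ≤tᵢ) = parts i
      n≤ : n ≤ suc s * m′
      n≤ = ≤-trans (≤-reflexive n≡ᵢ) (≤-trans (+-monoʳ-≤ (s * t i) uᵢ≤tᵢ)
             (≤-trans (≤-reflexive (+-comm (s * t i) (t i))) (*-monoʳ-≤ (suc s) (≤-pred tᵢ≤m′))))
      d≤s : d ≤ s
      d≤s = ≤-pred (*-cancelˡ-< m′ d (suc s) (<-≤-trans below (≤-trans n≤ (≤-reflexive (*-comm (suc s) m′)))))
      s*m≤n : s * suc m′ ≤ n
      s*m≤n = ≤-trans (*-monoʳ-≤ s m′<tᵢ′) (≤-trans (m≤m+n (s * t i′) (u i′)) (≤-reflexive (sym (proj₁ (parts i′)))))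
  in ≤-antisym above (≤-trans (≤-reflexive (*-comm (suc m′) d)) (≤-trans (*-monoˡ-≤ (suc m′) d≤s) s*m≤n))

¬colouring-below-p : ∀ k n b r0 e .{{_ : NonZero n}} → 2 ≤ k → 1 ≤ b → n ≡ 3 * b + r0 → r0 ≤ 1 → 3 ≤ e → ¬ (suc e ∣ n) →
      ¬ EqTreeColoring (Kk* k n) (pred (k * ((n + e) / suc e))) 1
¬colouring-below-p (suc zero) n b r0 e (s≤s ()) _ _ _ _ _ _
¬colouring-below-p (suc (suc k′)) n b r0 e _ b≥1 n≡ r0≤1 e≥3 d∤n col
  with (n + e) / suc e | ceilMultiple-bounds n e
     | ceilQuotient≤b n b e e≥3 b≥1 (≤-trans (≤-reflexive n≡) (+-monoʳ-≤ (3 * b) r0≤1)) (proj₂ (ceilMultiple-bounds n e))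
... | zero | (n≤0 , _) | _ = ≢-nonZero⁻¹ n (n≤0⇒n≡0 n≤0)
... | suc m′ | (n≤md , md<n+d) | m≤b =
  let k = suc (suc k′)
      q′ = m′ + (m′ + k′ * suc m′)
      q≡ : pred (k * suc m′) ≡ suc q′
      q≡ = +-suc m′ (m′ + k′ * suc m′)
      3q≤kn : 3 * suc q′ ≤ k * n
      3q≤kn = ≤-trans (*-monoʳ-≤ 3 (≤-trans (≤-reflexive (sym q≡)) (pred[n]≤n {k * suc m′})))
                (≤-trans (≤-reflexive (assoc3 k (suc m′))) (≤-trans (*-monoʳ-≤ k (*-monoʳ-≤ 3 m≤b))
                  (*-monoʳ-≤ k (≤-trans (m≤m+n (3 * b) r0) (≤-reflexive (sym n≡))))))
      (t , u , parts , ∑t≡q , _) = colouring⇒partDecomposition k n q′ (s≤s z≤n)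
                                     (subst (λ r → EqTreeColoring (Kk* k n) r 1) q≡ col) 3q≤kn
  in d∤n (divides (suc m′) (balancedParts⇒exact n ((k * n) / suc q′) m′ (suc e) t u parts
       (subst (_< k * suc m′) (sym ∑t≡q) (≤-reflexive (cong suc (sym q≡))))
       (subst (k * m′ <_) (sym ∑t≡q) (s≤s (m+o≡n⇒m≤n k′ (count-q k′ m′))))
       (+-cancelʳ-< (suc e) (m′ * suc e) n (subst (_< n + suc e) (+-comm (suc e) (m′ * suc e)) md<n+d))
       n≤md))
  where
  assoc3 : ∀ k m → 3 * (k * m) ≡ k * (3 * m)
  assoc3 = solve-∀
  count-q : ∀ k′ m′ → suc (suc k′) * m′ + k′ ≡ m′ + (m′ + k′ * suc m′)
  count-q = solve-∀

pairTriple-bound : ∀ k b r0 q → r0 ≤ 1 → (r0 ≡ 1 → k ≡ 2) → k * (3 * b + r0) ≤ 3 * q → k * (3 * b + r0) ≤ 2 * q + k * b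
pairTriple-bound k b zero q _ _ le =
  let kb : k * b ≤ q
      kb = *-cancelˡ-≤ 3 (≤-trans (≤-reflexive (r1 k b)) le) in
  ≤-trans (≤-reflexive (r2 k b)) (+-monoˡ-≤ (k * b) (*-monoʳ-≤ 2 kb))
  where r1 : ∀ k b → 3 * (k * b) ≡ k * (3 * b + 0)
        r1 = solve-∀
        r2 : ∀ k b → k * (3 * b + 0) ≡ 2 * (k * b) + k * b
        r2 = solve-∀
pairTriple-bound k b (suc zero) q _ k2 le with k2 refl
... | refl with 2 * b <? q
...   | yes lt = ≤-trans (≤-reflexive (r1 b)) (+-monoˡ-≤ (2 * b) (*-monoʳ-≤ 2 lt))
  where r1 : ∀ b → 2 * (3 * b + 1) ≡ 2 * suc (2 * b) + 2 * b
        r1 = solve-∀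
...   | no nlt = ⊥-elim (m+1+n≰m (3 * (2 * b)) {1} (subst (_≤ 3 * (2 * b)) (sym (r2 b)) (≤-trans le (*-monoʳ-≤ 3 (≮⇒≥ nlt)))))
  where r2 : ∀ b → 3 * (2 * b) + 2 ≡ 2 * (3 * b + 1)
        r2 = solve-∀
pairTriple-bound k b (suc (suc _)) q (s≤s ()) _ _

room-3b+1 : ∀ m b j → j ≢ 0 → 3 * m < 3 * b + 1 → 3 * (2 * m + j) < 2 * (3 * b + 1) → suc m * 3 ≤ 3 * b + 1
room-3b+1 m b j j≢0 3m<n 3q<2n with m <? b
... | yes m<b = ≤-trans (≤-reflexive (*-comm (suc m) 3)) (≤-trans (*-monoʳ-≤ 3 m<b) (m≤m+n (3 * b) 1))
... | no m≮b = ⊥-elim (<-irrefl refl (<-≤-trans 3q<2n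
      (≤-trans (≤-reflexive (cong (λ t → 2 * (3 * t + 1)) (sym m≡b)))
        (≤-trans (m+o≡n⇒m≤n 1 (lem m)) (*-monoʳ-≤ 3 (+-monoʳ-≤ (2 * m) (n≢0⇒n>0 j≢0)))))))
  where
  m≡b : m ≡ b
  m≡b = ≤-antisym (*-cancelˡ-≤ 3 (≤-pred (≤-trans 3m<n (≤-reflexive (+-comm (3 * b) 1))))) (≮⇒≥ m≮b)
  lem : ∀ m → 2 * (3 * m + 1) + 1 ≡ 3 * (2 * m + 1)
  lem = solve-∀

-- Colour each part with m blocks of sizes s, s + 1 where s = ⌊(n − 1) / m⌋, and j of the
-- parts with m + 1 blocks.  The latter fits because 3 ≤ s < d, so s divides n by the
-- minimality of d, except in the case s = 3, n = 3b + 1, which needs room-3b+1.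
partwiseColouring-above-p : ∀ K n b r0 e m j .{{_ : NonZero n}} → n ≡ 3 * b + r0 → (r0 ≡ 1 → K ≡ 2) → j < K →
  n ≤ (n + e) / suc e * suc e → (n + e) / suc e ≤ m → 3 * m < n → 3 * (K * m + j) < K * n →
  (∀ d′ → 3 ≤ d′ → d′ < suc e → (d′ ≡ 3 → r0 ≡ 1 → ⊥) → d′ ∣ n) →
  EqTreeColoring (Kk* K n) (K * m + j) 1
partwiseColouring-above-p K (suc n′) b r0 e zero j n≡ r0≡1⇒K≡2 j<K n≤ m₀≤m 3m<n 3q<Kn divs
  = ⊥-elim (≢-nonZero⁻¹ (suc n′) (n≤0⇒n≡0 (≤-trans n≤ (≤-reflexive (cong (_* suc e) (n≤0⇒n≡0 m₀≤m))))))
partwiseColouring-above-p K (suc n′) b r0 e m@(suc _) j n≡ r0≡1⇒K≡2 j<K n≤ m₀≤m 3m<n 3q<Kn divs =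
  partwiseColouring K (suc n′) m j s (<⇒≤ j<K) (≤-trans ms≤n′ (n≤1+n n′)) (proj₂ (/-bounds n′ m)) (room (j ≟ 0))
  where
  s = n′ / m
  ms≤n′ : m * s ≤ n′
  ms≤n′ = proj₁ (/-bounds n′ m)
  s≥3 : 3 ≤ s
  s≥3 = ≤-trans (≤-reflexive (sym (m*n/n≡m 3 m))) (/-monoˡ-≤ m (≤-pred 3m<n))
  s<d : s < suc e
  s<d = *-cancelˡ-< m s (suc e) (≤-trans (s≤s ms≤n′) (≤-trans n≤ (*-monoˡ-≤ (suc e) m₀≤m)))
  s≡3∧r0≡1 : s ≡ 3 → r0 ≡ 1 → j ≢ 0 → suc m * s ≤ suc n′
  s≡3∧r0≡1 s≡3 r0≡1 j≢0 with r0≡1⇒K≡2 r0≡1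
  ... | refl = subst (λ t → suc m * t ≤ suc n′) (sym s≡3) (subst (suc m * 3 ≤_) (sym n≡3b+1)
        (room-3b+1 m b j j≢0 (subst (3 * m <_) n≡3b+1 3m<n) (subst (λ t → 3 * (2 * m + j) < 2 * t) n≡3b+1 3q<Kn)))
    where
    n≡3b+1 : suc n′ ≡ 3 * b + 1
    n≡3b+1 = trans n≡ (cong (3 * b +_) r0≡1)
  one-more : j ≢ 0 → suc m * s ≤ suc n′
  one-more j≢0 with s ≟ 3 | r0 ≟ 1
  ... | yes s≡3 | yes r0≡1 = s≡3∧r0≡1 s≡3 r0≡1 j≢0
  ... | yes s≡3 | no r0≢1 = ∣⇒next-multiple≤ m s (suc n′) (s≤s ms≤n′) (divs s s≥3 s<d (λ _ r0≡1 → r0≢1 r0≡1))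
  ... | no s≢3 | _ = ∣⇒next-multiple≤ m s (suc n′) (s≤s ms≤n′) (divs s s≥3 s<d (λ s≡3 _ → s≢3 s≡3))
  room : Dec (j ≡ 0) → j ≡ 0 ⊎ (suc m * s ≤ suc n′ × suc n′ ≤ suc m * suc s)
  room (yes j≡0) = inj₁ j≡0
  room (no j≢0) = inj₂ (one-more j≢0 , ≤-trans (proj₂ (/-bounds n′ m)) (*-monoˡ-≤ (suc s) (n≤1+n m)))

colouring-above-p : ∀ k n b r0 e .{{_ : NonZero n}} → 2 ≤ k → n ≡ 3 * b + r0 → r0 ≤ 1 → (r0 ≡ 1 → k ≡ 2) →
  (∀ d′ → 3 ≤ d′ → d′ < suc e → (d′ ≡ 3 → r0 ≡ 1 → ⊥) → d′ ∣ n) →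
  ∀ q → k * ((n + e) / suc e) ≤ q → EqTreeColoring (Kk* k n) q 1
colouring-above-p k n b r0 e k≥2 n≡ r0≤1 r0≡1⇒k≡2 divs q kp≤q with k * n ≤? 2 * q | k * n ≤? 3 * q
... | yes kn≤2q | _ = smallClassColouring k n q kn≤2q
... | no kn≰2q | yes kn≤3q = pairTripleColouring k n q b r0 n≡ (≤-trans (s≤s z≤n) k≥2) (<⇒≤ (≰⇒> kn≰2q)) kn≤3q
      (subst (λ t → k * t ≤ 2 * q + k * b) (sym n≡) (pairTriple-bound k b r0 q r0≤1 r0≡1⇒k≡2 (subst (λ t → k * t ≤ 3 * q) n≡ kn≤3q)))
... | no _ | no kn≰3q = subst (λ t → EqTreeColoring (Kk* k n) t 1) (sym q≡)
      (partwiseColouring-above-p k n b r0 e m j n≡ r0≡1⇒k≡2 (m%n<n q k) (proj₁ (ceilMultiple-bounds n e)) m₀≤m 3m<n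
         (subst (λ t → 3 * t < k * n) q≡ (≰⇒> kn≰3q)) divs)
  where
  instance
    k≢0 : NonZero k
    k≢0 = >-nonZero (≤-trans (s≤s z≤n) k≥2)
  m = q / k
  j = q % k
  q≡ : q ≡ k * m + j
  q≡ = trans (m≡m%n+[m/n]*n q k) (trans (+-comm j (m * k)) (cong (_+ j) (*-comm m k)))
  m₀≤m : (n + e) / suc e ≤ m
  m₀≤m = ≤-trans (≤-reflexive (sym (m*n/n≡m ((n + e) / suc e) k))) (/-monoˡ-≤ k (≤-trans (≤-reflexive (*-comm ((n + e) / suc e) k)) kp≤q))
  3m<n : 3 * m < n
  3m<n = *-cancelʳ-< k (3 * m) n (≤-<-trans (≤-trans (≤-reflexive (*-assoc 3 m k)) (*-monoʳ-≤ 3 (m/n*n≤m q k)))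
           (subst (3 * q <_) (*-comm k n) (≰⇒> kn≰3q)))

IsVA-p : ∀ k n b r0 e .{{_ : NonZero n}} → 2 ≤ k → 1 ≤ b → n ≡ 3 * b + r0 → r0 ≤ 1 → (r0 ≡ 1 → k ≡ 2) → 3 ≤ e → ¬ (suc e ∣ n) →
  (∀ d′ → 3 ≤ d′ → d′ < suc e → (d′ ≡ 3 → r0 ≡ 1 → ⊥) → d′ ∣ n) →
  IsVA (Kk* k n) 1 (k * ((n + e) / suc e))
IsVA-p k n b r0 e k≥2 b≥1 n≡ r0≤1 r0≡1⇒k≡2 e≥3 d∤n divs =
  IsVA-intro (Kk* k n) (k * ((n + e) / suc e)) (*-mono-≤ (≤-trans (s≤s z≤n) k≥2) 1≤m₀)
    (colouring-above-p k n b r0 e k≥2 n≡ r0≤1 r0≡1⇒k≡2 divs) (¬colouring-below-p k n b r0 e k≥2 b≥1 n≡ r0≤1 e≥3 d∤n)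
  where
  1≤m₀ : 1 ≤ (n + e) / suc e
  1≤m₀ with (n + e) / suc e in eq
  ... | zero = ⊥-elim (≢-nonZero⁻¹ n (n≤0⇒n≡0 (subst (λ t → n ≤ t * suc e) eq (proj₁ (ceilMultiple-bounds n e)))))
  ... | suc _ = s≤s z≤n

DCond-nonDivisor : ∀ {k} (ns : Vec ℕ k) n e → 2 ≤ k → (∀ i → lookup ns i ≡ n) → ¬ (suc e ∣ n) → DCond ns (suc e)
DCond-nonDivisor {suc zero} ns n e (s≤s ()) lk nd
DCond-nonDivisor {suc (suc k)} ns n e _ lk nd = inj₁ (zero , suc zero , (λ ()) , (λ x → nd (subst (suc e ∣_) (lk zero) x)) , λ x → nd (subst (suc e ∣_) (lk (suc zero)) x))

¬DCond-divisor : ∀ {k} (ns : Vec ℕ k) n d → (∀ i → lookup ns i ≡ n) → d ∣ n → ¬ DCond ns d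
¬DCond-divisor ns n zero lk dv ()
¬DCond-divisor ns n (suc e) lk dv (inj₁ (i , j , _ , ni , _)) = ni (subst (suc e ∣_) (sym (lk i)) dv)
¬DCond-divisor ns n (suc e) lk (divides w eqw) (inj₂ (i , lt)) rewrite lk i =
  <-irrefl refl (<-≤-trans lt (≤-trans (≤-reflexive (trans eqw (trans (cong (_* suc e) (sym wq)) (*-comm (n / suc e) (suc e)))))
      (*-monoˡ-≤ (n / suc e) (m≤m+n (suc e) 1))))
  where
  wq : n / suc e ≡ w
  wq = trans (cong (_/ suc e) eqw) (m*n/n≡m w (suc e))

-- For equal part sizes, condition (i) in the definition of d says d ∤ n and (ii) fails
-- whenever d ∣ n, so d is the least non-divisor of n from ⌈kn/q⌉ = 3 + r0 on.
va≡p : ∀ k n b r0 .{{_ : NonZero n}} → 2 ≤ k → 1 ≤ b → n ≡ 3 * b + r0 → r0 ≤ 1 → (r0 ≡ 1 → k ≡ 2) →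
  (∀ q′ → suc q′ ≡ k * b → ⌈ V.sum (replicate k n) /suc q′ ⌉ ≡ 3 + r0) →
  (∀ d′ → 3 ≤ d′ → (d′ ≡ 3 → r0 ≡ 1 → ⊥) → 3 + r0 ≤ d′) →
  (r0 ≡ 0 → 3 ∣ n) →
  Σ ℕ λ v → IsP (k * b) (replicate k n) v × IsVA (Kk* k n) 1 v
va≡p k n b r0 k≥2 b≥1 n≡ r0≤1 r0≡1⇒k≡2 ⌈N/q⌉≡3+r0 3+r0≤ 3∣n =
  let (d , 3+r0≤d , d∤n , below-d⇒∣) = least (λ d → ¬ (d ∣ n)) (λ d → ¬? (d ∣? n)) (3 + r0) (suc n) 3+r0≤1+n (λ x → 1+n≰n (∣⇒≤ x)) in
  go d 3+r0≤d d∤n below-d⇒∣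
  where
  3+r0≤1+n : 3 + r0 ≤ suc n
  3+r0≤1+n = ≤-trans (+-monoˡ-≤ r0 (*-monoʳ-≤ 3 b≥1)) (≤-trans (≤-reflexive (sym n≡)) (n≤1+n n))
  go : ∀ d → 3 + r0 ≤ d → ¬ (d ∣ n) → (∀ d′ → 3 + r0 ≤ d′ → d′ < d → ¬ ¬ (d′ ∣ n)) →
       Σ ℕ λ v → IsP (k * b) (replicate k n) v × IsVA (Kk* k n) 1 v
  go zero () _ _
  go (suc e) 3+r0≤d d∤n below-d⇒∣ = v , IsP-v , IsVA-p k n b r0 e k≥2 b≥1 n≡ r0≤1 r0≡1⇒k≡2 e≥3 d∤n divs
    where
    v = k * ((n + e) / suc e)
    e≥3 : 3 ≤ e
    e≥3 with suc e ≟ 3 | r0 ≟ 0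
    ... | yes d3 | yes r00 = ⊥-elim (d∤n (subst (_∣ n) (sym d3) (3∣n r00)))
    ... | yes d3 | no r0n = ⊥-elim (1+n≰n (≤-trans (+-monoʳ-≤ 3 (n≢0⇒n>0 r0n)) (≤-trans 3+r0≤d (≤-reflexive d3))))
    ... | no d3 | _ = ≤-pred (≤∧≢⇒< (≤-trans (m≤m+n 3 r0) 3+r0≤d) (λ x → d3 (sym x)))
    divs : ∀ d′ → 3 ≤ d′ → d′ < suc e → (d′ ≡ 3 → r0 ≡ 1 → ⊥) → d′ ∣ n
    divs d′ l3 lt h = decidable-stable (d′ ∣? n) (below-d⇒∣ d′ (3+r0≤ d′ l3 h) lt)
    lookup≡n : ∀ i → lookup (replicate k n) i ≡ n
    lookup≡n i = lookup-replicate i n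
    v≡sumCeil : v ≡ sumCeil (replicate k n) (suc e)
    v≡sumCeil = sym (trans (cong V.sum (map-replicate (λ x → ⌈ x /suc e ⌉) n k)) (sum-replicate k _))
    IsP-d : ∀ Q → Q ≡ k * b → IsP Q (replicate k n) v
    IsP-d zero eq = ⊥-elim (<-irrefl refl (≤-trans (*-mono-≤ (≤-trans (s≤s z≤n) k≥2) b≥1) (≤-reflexive (sym eq))))
    IsP-d (suc q′) eq = suc e , (subst (_≤ suc e) (sym (⌈N/q⌉≡3+r0 q′ eq)) 3+r0≤d ,
        DCond-nonDivisor (replicate k n) n e k≥2 lookup≡n d∤n ,
        (λ d′ l lt → ¬DCond-divisor (replicate k n) n d′ lookup≡n (decidable-stable (d′ ∣? n) (below-d⇒∣ d′ (subst (_≤ d′) (⌈N/q⌉≡3+r0 q′ eq) l) lt)))) , v≡sumCeil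
    IsP-v : IsP (k * b) (replicate k n) v
    IsP-v = IsP-d (k * b) refl

-- The five cases

va-K₁₁ : IsVA (K (1 ∷ 1 ∷ [])) 1 1
va-K₁₁ = IsVA-intro (Kk* 2 1) 1 (s≤s z≤n) (λ q le → smallClassColouring 2 1 q (*-monoʳ-≤ 2 le)) (¬colouring-zero (Kk* 2 1) 1 (s≤s z≤n))

va-Kk*1 : ∀ k → 3 ≤ k → IsVA (Kk* k 1) 1 ⌈ k /2⌉
va-Kk*1 (suc zero) (s≤s ())
va-Kk*1 (suc (suc zero)) (s≤s (s≤s ()))
va-Kk*1 k@(suc (suc (suc _))) k≥3 = IsVA-intro (Kk* k 1) ⌈ k /2⌉ (s≤s z≤n)
  (λ q le → smallClassColouring k 1 q (≤-trans (≤-reflexive (*-identityʳ k)) (≤-trans (n≤2⌈n/2⌉ k) (*-monoʳ-≤ 2 le))))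
  (λ col → let bound = colouring⇒N≤2q+k⌊n/3⌋ k 1 (pred ⌈ k /2⌉) (s≤s z≤n) col (inj₂ (s≤s z≤n)) in
     2*[1+c]≤1+n⇒n≰2*c k (pred ⌈ k /2⌉) (2⌈n/2⌉≤1+n k)
       (≤-trans (≤-reflexive (sym (*-identityʳ k)))
         (≤-trans bound (≤-reflexive (trans (cong (2 * pred ⌈ k /2⌉ +_) (*-zeroʳ k)) (+-identityʳ _))))))

va-K₂₂ : IsVA (K (2 ∷ 2 ∷ [])) 1 2
va-K₂₂ = IsVA-intro (Kk* 2 2) 2 (s≤s z≤n) (λ q le → smallClassColouring 2 2 q (*-monoʳ-≤ 2 le)) (λ col → lem (colouring⇒N≤2q+k⌊n/3⌋ 2 2 1 (s≤s z≤n) col (inj₂ ≤-refl)))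
  where lem : 4 ≤ 2 → ⊥
        lem (s≤s (s≤s ()))

va-Kk*2 : ∀ k → 3 ≤ k → IsVA (Kk* k 2) 1 k
va-Kk*2 (suc k′) k3 = IsVA-intro (Kk* (suc k′) 2) (suc k′) (s≤s z≤n)
  (λ q le → smallClassColouring (suc k′) 2 q (≤-trans (≤-reflexive (*-comm (suc k′) 2)) (*-monoʳ-≤ 2 le)))
  (λ col → let h = colouring⇒N≤2q+k⌊n/3⌋ (suc k′) 2 k′ (s≤s z≤n) col (inj₂ ≤-refl) in
     <-irrefl refl (<-≤-trans (≤-trans (s≤s (≤-reflexive (*-comm 2 k′))) (n≤1+n _))
        (≤-trans h (≤-reflexive (trans (cong (2 * k′ +_) (*-zeroʳ (suc k′))) (+-identityʳ _))))))

va-Knn-3b : ∀ b → 1 ≤ b → Σ ℕ λ v → IsP (2 * b) (3 * b ∷ 3 * b ∷ []) v × IsVA (K (3 * b ∷ 3 * b ∷ [])) 1 v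
va-Knn-3b (suc b′) b1 = va≡p 2 (3 * suc b′) (suc b′) 0 ≤-refl b1 (sym (+-identityʳ _)) z≤n (λ ())
  (λ q′ eq → ⌈3q/q⌉≡3 _ q′ (trans (sum-replicate 2 (3 * suc b′)) (trans (r (suc b′)) (cong (3 *_) (sym eq)))))
  (λ d′ l3 _ → l3) (λ _ → divides (suc b′) (*-comm 3 (suc b′)))
  where r : ∀ b → 2 * (3 * b) ≡ 3 * (2 * b)
        r = solve-∀

va-Kk*3b : ∀ k b → 3 ≤ k → 1 ≤ b → Σ ℕ λ v → IsP (k * b) (replicate k (3 * b)) v × IsVA (Kk* k (3 * b)) 1 v
va-Kk*3b k (suc b′) k3 b1 = va≡p k (3 * suc b′) (suc b′) 0 (≤-trans (n≤1+n 2) k3) b1 (sym (+-identityʳ _)) z≤n (λ ())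
  (λ q′ eq → ⌈3q/q⌉≡3 _ q′ (trans (sum-replicate k (3 * suc b′)) (trans (r k (suc b′)) (cong (3 *_) (sym eq)))))
  (λ d′ l3 _ → l3) (λ _ → divides (suc b′) (*-comm 3 (suc b′)))
  where r : ∀ k b → k * (3 * b) ≡ 3 * (k * b)
        r = solve-∀

va-Knn-3b+1 : ∀ b → 1 ≤ b → Σ ℕ λ v → IsP (2 * b) (3 * b + 1 ∷ 3 * b + 1 ∷ []) v × IsVA (K (3 * b + 1 ∷ 3 * b + 1 ∷ [])) 1 v
va-Knn-3b+1 (suc b′) b1 = va≡p 2 (3 * suc b′ + 1) (suc b′) 1 ≤-refl b1 refl ≤-refl (λ _ → refl)
  (λ q′ eq → ⌈3q+2/q⌉≡4 _ q′ (q1 q′ eq) (trans (sum-replicate 2 (3 * suc b′ + 1)) (trans (r (suc b′)) (cong (λ t → 3 * t + 2) (sym eq)))))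
  (λ d′ l3 h → ≤∧≢⇒< l3 (λ e → h (sym e) refl)) (λ ())
  where r : ∀ b → 2 * (3 * b + 1) ≡ 3 * (2 * b) + 2
        r = solve-∀
        q1 : ∀ q′ → suc q′ ≡ 2 * suc b′ → 1 ≤ q′
        q1 zero eq = ⊥-elim (0≢1+n (suc-injective (trans eq (cong suc (+-suc b′ (b′ + 0))))))
        q1 (suc _) _ = s≤s z≤n

colouring-Kk*3b+1 : ∀ k b → 3 ≤ k → 1 ≤ b → ∀ q → k * b + ⌈ k /2⌉ ≤ q → EqTreeColoring (Kk* k (3 * b + 1)) q 1
colouring-Kk*3b+1 k b@(suc _) k≥3 _ = colouring-above-pairTriple k (3 * b + 1) b 1 (k * b + c) refl (≤-trans (s≤s z≤n) k≥3)
  (λ q p≤q → ≤-trans (≤-reflexive (expand k b)) (≤-trans (+-monoʳ-≤ (3 * (k * b)) (≤-trans (n≤2⌈n/2⌉ k) (*-monoˡ-≤ c {2} {3} (s≤s (s≤s z≤n)))))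
               (≤-trans (≤-reflexive (sym (*-distribˡ-+ 3 (k * b) c))) (*-monoʳ-≤ 3 p≤q))) ,
             ≤-trans (≤-reflexive (expand k b)) (≤-trans (+-monoʳ-≤ (3 * (k * b)) (n≤2⌈n/2⌉ k))
               (≤-trans (≤-reflexive (regroup (k * b) c)) (+-monoˡ-≤ (k * b) (*-monoʳ-≤ 2 p≤q)))))
  where
  c = ⌈ k /2⌉
  expand : ∀ k b → k * (3 * b + 1) ≡ 3 * (k * b) + k
  expand = solve-∀
  regroup : ∀ x c → 3 * x + 2 * c ≡ 2 * (x + c) + x
  regroup = solve-∀

-- For k ≠ 4 the counting bound applies; for k = 4 it is one short, but then kn = 3q + 1.
¬colouring-Kk*3b+1 : ∀ k b c′ → 3 ≤ k → 1 ≤ b → ⌈ k /2⌉ ≡ suc c′ → ¬ EqTreeColoring (Kk* k (3 * b + 1)) (k * b + c′) 1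
¬colouring-Kk*3b+1 k b@(suc b′) c′ k≥3 _ c≡ col with k ≟ 4
... | yes refl = ¬colouring-3q+1 2 n b 1 (4 * b) refl (s≤s z≤n) (s≤s (s≤s z≤n))
      (subst (λ t → EqTreeColoring (Kk* 4 n) t 1) (trans (cong (4 * b +_) (sym (suc-injective c≡))) (+-comm (4 * b) 1)) col)
      (r3 b) (m+o≡n⇒m≤n (4 * b′ + 3) (r4 b′))
  where
  n = 3 * b + 1
  r3 : ∀ b → 4 * (3 * b + 1) ≡ 3 * suc (4 * b) + 1
  r3 = solve-∀
  r4 : ∀ b′ → suc (4 * (3 * suc b′ + 1)) + (4 * b′ + 3) ≡ 3 * suc (4 * suc b′) + suc (4 * suc b′)
  r4 = solve-∀
... | no k≢4 =
  let k≤3c′ : k ≤ 3 * c′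
      k≤3c′ = +-cancelʳ-≤ 3 k (3 * c′) (≤-trans (subst (λ t → k + 3 ≤ 3 * t) c≡ (k+3≤3⌈k/2⌉ k ⌈ k /2⌉ k≥3 k≢4 (⌈/2⌉-spec k)))
                (≤-reflexive (trans (*-suc 3 c′) (+-comm 3 (3 * c′)))))
      bound = colouring⇒N≤2q+k⌊n/3⌋ k (3 * b + 1) (k * b + c′) (≤-trans (s≤s z≤n) k≥3) col
                (inj₁ (≤-trans (≤-reflexive (expand k b)) (≤-trans (+-monoʳ-≤ (3 * (k * b)) k≤3c′) (≤-reflexive (sym (*-distribˡ-+ 3 (k * b) c′))))))
  in 2*[1+c]≤1+n⇒n≰2*c k c′ (subst (λ t → 2 * t ≤ suc k) c≡ (2⌈n/2⌉≤1+n k))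
       (+-cancelˡ-≤ (3 * (k * b)) k (2 * c′) (≤-trans (≤-reflexive (sym (expand k b)))
         (≤-trans bound (≤-reflexive (trans (cong (λ t → 2 * (k * b + c′) + k * t) ([3b+r]/3≡b b 1 (s≤s (s≤s z≤n)))) (regroup (k * b) c′))))))
  where
  expand : ∀ k b → k * (3 * b + 1) ≡ 3 * (k * b) + k
  expand = solve-∀
  regroup : ∀ x c′ → 2 * (x + c′) + x ≡ 3 * x + 2 * c′
  regroup = solve-∀

va-Kk*3b+1 : ∀ k b → 3 ≤ k → 1 ≤ b → IsVA (Kk* k (3 * b + 1)) 1 (k * b + ⌈ k /2⌉)
va-Kk*3b+1 (suc zero) _ (s≤s ()) _
va-Kk*3b+1 (suc (suc zero)) _ (s≤s (s≤s ())) _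
va-Kk*3b+1 k@(suc (suc (suc _))) b k≥3 b≥1 =
  IsVA-intro (Kk* k (3 * b + 1)) (k * b + ⌈ k /2⌉) (≤-trans (s≤s z≤n) (m≤n+m ⌈ k /2⌉ (k * b)))
    (colouring-Kk*3b+1 k b k≥3 b≥1)
    (λ col → ¬colouring-Kk*3b+1 k b (pred ⌈ k /2⌉) k≥3 b≥1 refl
      (subst (λ t → EqTreeColoring (Kk* k (3 * b + 1)) t 1) (cong pred (+-suc (k * b) (pred ⌈ k /2⌉))) col))

va-Knn-3b+2 : ∀ b → 1 ≤ b → IsVA (K (3 * b + 2 ∷ 3 * b + 2 ∷ [])) 1 (2 * b + 2)
va-Knn-3b+2 (suc b′) b1 = IsVA-intro (Kk* 2 n) (2 * b + 2) (≤-trans (s≤s z≤n) (m≤n+m 2 (2 * b)))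
  (colouring-above-pairTriple 2 n b 2 (2 * b + 2) refl (s≤s z≤n)
     (λ q le → ≤-trans (m+o≡n⇒m≤n 2 (r1 b)) (*-monoʳ-≤ 3 le) , ≤-trans (≤-reflexive (r2 b)) (+-monoˡ-≤ (2 * b) (*-monoʳ-≤ 2 le))))
  (λ col → ¬colouring-3q+1 0 n b 2 (2 * b) refl (s≤s z≤n) ≤-refl (subst (λ t → EqTreeColoring (Kk* 2 n) t 1) (cong pred (+-comm (2 * b) 2)) col)
     (r3 b) (m+o≡n⇒m≤n (suc (2 * b′)) (r4 b′)))
  where
  b = suc b′
  n = 3 * b + 2
  r1 : ∀ b → 2 * (3 * b + 2) + 2 ≡ 3 * (2 * b + 2)
  r1 = solve-∀
  r2 : ∀ b → 2 * (3 * b + 2) ≡ 2 * (2 * b + 2) + 2 * b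
  r2 = solve-∀
  r3 : ∀ b → 2 * (3 * b + 2) ≡ 3 * suc (2 * b) + 1
  r3 = solve-∀
  r4 : ∀ b′ → suc (2 * (3 * suc b′ + 2)) + suc (2 * b′) ≡ 3 * suc (2 * suc b′) + suc (2 * suc b′)
  r4 = solve-∀

va-Kk*3b+2 : ∀ k b → 3 ≤ k → 1 ≤ b → IsVA (Kk* k (3 * b + 2)) 1 (k * b + k)
va-Kk*3b+2 (suc zero) _ (s≤s ()) _
va-Kk*3b+2 (suc (suc zero)) _ (s≤s (s≤s ())) _
va-Kk*3b+2 k@(suc (suc (suc k″))) b@(suc b′) k3 b1 = IsVA-intro (Kk* k n) (k * b + k) (≤-trans (s≤s z≤n) (m≤n+m k (k * b)))
  (colouring-above-pairTriple k n b 2 (k * b + k) refl (s≤s z≤n)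
     (λ q le → ≤-trans (m+o≡n⇒m≤n k (r1 k b)) (*-monoʳ-≤ 3 le) , ≤-trans (≤-reflexive (r2 k b)) (+-monoˡ-≤ (k * b) (*-monoʳ-≤ 2 le))))
  (λ col →
     let col′ = subst (λ t → EqTreeColoring (Kk* k n) t 1) (cong pred (+-suc (k * b) (suc (suc k″)))) col in
     let h = colouring⇒N≤2q+k⌊n/3⌋ k n (k * b + suc (suc k″)) (s≤s z≤n) col′ (inj₁ (m+o≡n⇒m≤n k″ (r3 k″ b))) in
     <-irrefl refl (<-≤-trans (m+o≡n⇒m≤n 1 (r4 k″ b)) (≤-trans h (≤-reflexive (cong (λ t → 2 * (k * b + suc (suc k″)) + k * t) ([3b+r]/3≡b b 2 ≤-refl))))))
  where
  n = 3 * b + 2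
  r1 : ∀ k b → k * (3 * b + 2) + k ≡ 3 * (k * b + k)
  r1 = solve-∀
  r2 : ∀ k b → k * (3 * b + 2) ≡ 2 * (k * b + k) + k * b
  r2 = solve-∀
  r3 : ∀ k″ b → (3 + k″) * (3 * b + 2) + k″ ≡ 3 * ((3 + k″) * b + (2 + k″))
  r3 = solve-∀
  r4 : ∀ k″ b → suc (2 * ((3 + k″) * b + (2 + k″)) + (3 + k″) * b) + 1 ≡ (3 + k″) * (3 * b + 2)
  r4 = solve-∀

theorem3 : ∀ (k b : ℕ) → 3 ≤ k → 1 ≤ b →
    (IsVA (K (1 ∷ 1 ∷ [])) 1 1 × IsVA (Kk* k 1) 1 ⌈ k /2⌉)
    × (IsVA (K (2 ∷ 2 ∷ [])) 1 2 × IsVA (Kk* k 2) 1 k)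
    × ((Σ ℕ λ v → IsP (2 * b) (3 * b ∷ 3 * b ∷ []) v × IsVA (K (3 * b ∷ 3 * b ∷ [])) 1 v)
    × (Σ ℕ λ v → IsP (k * b) (replicate k (3 * b)) v × IsVA (Kk* k (3 * b)) 1 v))
    × ((Σ ℕ λ v → IsP (2 * b) (3 * b + 1 ∷ 3 * b + 1 ∷ []) v
    × IsVA (K (3 * b + 1 ∷ 3 * b + 1 ∷ [])) 1 v)
    × IsVA (Kk* k (3 * b + 1)) 1 (k * b + ⌈ k /2⌉))
    × (IsVA (K (3 * b + 2 ∷ 3 * b + 2 ∷ [])) 1 (2 * b + 2)
    × IsVA (Kk* k (3 * b + 2)) 1 (k * b + k))
theorem3 k b k≥3 b≥1 =
    (va-K₁₁ , va-Kk*1 k k≥3)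
  , (va-K₂₂ , va-Kk*2 k k≥3)
  , (va-Knn-3b b b≥1 , va-Kk*3b k b k≥3 b≥1)
  , (va-Knn-3b+1 b b≥1 , va-Kk*3b+1 k b k≥3 b≥1)
  , (va-Knn-3b+2 b b≥1 , va-Kk*3b+2 k b k≥3 b≥1)
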